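{- Every character $\zeta$ of $\widetilde{\Lambda}$ is uniquely determined by the sequence $a_n:=\zeta(\widetilde{m}_n)$, $n\ge1$; writing $\zeta_a$ for the character with sequence $a=(a_n)$, one has for every weighted graph $G$ $$\zeta_a(X_G)=\sum_{\lambda}|\mathrm{St}_\lambda(G)|\,a_{\lambda_1}\cdots a_{\lambda_\ell},$$ and the convolution $\zeta_a*\zeta_b$ is the character whose sequence has $n$-th term $a_n+b_n$.
   Context: Work over a field $\mathbb{K}$ of characteristic $0$. A weighted graph is a finite simple graph with vertex weights $w:V(G)\to\{1,2,\dots\}$; $X_G=\sum_\kappa\prod_{v}x_{\kappa(v)}^{w(v)}$ over proper colorings $\kappa:V(G)\to\{1,2,\dots\}$ is its chromatic symmetric function. $\widetilde{m}_\lambda:=m_\lambda\prod_i r_i(\lambda)!$ ($m_\lambda$ the monomial symmetric function, $r_i(\lambda)$ the multiplicity of $i$ in $\lambda$). $\widetilde{\Lambda}$ is the space of symmetric functions with product $\odot$ given by $\widetilde{m}_\lambda\odot\widetilde{m}_\mu=\widetilde{m}_{\lambda\sqcup\mu}$ ($\lambda\sqcup\mu$ = union of the parts), and with the coproduct $\Delta$ of the Hopf algebra of symmetric functions (the algebra map for the ordinary product with $\Delta p_n=p_n\otimes1+1\otimes p_n$); with these, $\widetilde{\Lambda}$ is a Hopf algebra. A character of $\widetilde{\Lambda}$ is a $\mathbb{K}$-linear map $\zeta:\widetilde\Lambda\to\mathbb{K}$ with $\zeta(1)=1$ and $\zeta(f\odot g)=\zeta(f)\zeta(g)$. Convolution: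 $(\zeta*\xi)(f)=\sum\zeta(f_1)\xi(f_2)$ where $\Delta f=\sum f_1\otimes f_2$. $\mathrm{St}_\lambda(G)$ is the set of partitions of $V(G)$ into stable (independent) sets whose weights, as a multiset, are the parts $\lambda_1,\dots,\lambda_\ell$ of $\lambda$. -}

module Defs where

open import Level using (Level; _⊔_)
open import Data.Nat as ℕ using (ℕ; zero; suc; _∸_; _≤_; _<_; _≤?_; _<?_)
open import Data.Nat.ListAction using (sum)
open import Data.Nat.Properties using (≤-decTotalOrder; ≤-totalOrder)
import Data.Nat.Properties as ℕP
open import Data.Fin using (Fin; toℕ)
import Data.Fin as F
import Data.Fin.Properties as FP
open import Data.Bool using (Bool; true; false; T; not; _∧_; _∨_; if_then_else_)
open import Data.List using (List; []; _∷_; _++_; map; filter; length; foldr; concatMap; allFin; upTo; lookup)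
open import Data.Bool.ListAction using (and)
import Data.List.Properties as LP
open import Data.List.Relation.Unary.All using (All)
open import Data.List.Relation.Unary.All.Properties using (all-filter)
open import Data.List.Relation.Binary.Permutation.Propositional using (↭-sym)
open import Data.List.Relation.Binary.Permutation.Propositional.Properties using (All-resp-↭)
open import Data.Product using (Σ; _×_; _,_; proj₁; proj₂; ∃)
open import Relation.Nullary using (¬_; Dec; yes; no; does)
open import Relation.Nullary.Decidable using (⌊_⌋)
open import Relation.Binary.PropositionalEquality using (_≡_; refl)
open import Algebra.Bundles using (CommutativeRing)
import Data.List.Sort as Sort
open import Data.List.Relation.Unary.Sorted.TotalOrder ≤-totalOrder using (Sorted)
import Relation.Binary.Bundles

record Field (c ℓ : Level) : Set (Level.suc (c ⊔ ℓ)) where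
  field
    commutativeRing : CommutativeRing c ℓ
  open CommutativeRing commutativeRing public
  field
    1≉0     : ¬ (1# ≈ 0#)
    inverse : ∀ x → ¬ (x ≈ 0#) → Σ Carrier (λ y → (x * y) ≈ 1#)

module FieldOps {c ℓ} (K : Field c ℓ) where
  open Field K

  fromℕ : ℕ → Carrier
  fromℕ zero    = 0#
  fromℕ (suc n) = 1# + fromℕ n

  Σᴷ : List Carrier → Carrier
  Σᴷ = foldr _+_ 0#

  Πᴷ : List Carrier → Carrier
  Πᴷ = foldr _*_ 1#

CharZero : ∀ {c ℓ} → Field c ℓ → Set ℓ
CharZero K = ∀ n → ¬ (fromℕ (suc n) ≈ 0#)
  where open Field K ; open FieldOps K

-- Integer partitions, stored as the (weakly increasing) list of their
-- positive parts.

open import Data.List.Sort.MergeSort ≤-decTotalOrder using (mergeSort)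
open import Data.List.Sort.Base ≤-totalOrder using (SortingAlgorithm)
open SortingAlgorithm mergeSort using (sort; sort-↭; sort-↗)

record Partition : Set where
  constructor mkP
  field
    parts   : List ℕ
    .sorted : Sorted parts
    .pos    : All (λ k → 1 ≤ k) parts
open Partition public

allB : ∀ {A : Set} → (A → Bool) → List A → Bool
allB p xs = and (map p xs)

toPartition : List ℕ → Partition
toPartition l = mkP (sort (filter (1 ≤?_) l)) (sort-↗ (filter (1 ≤?_) l))
  (All-resp-↭ (↭-sym (sort-↭ (filter (1 ≤?_) l))) (all-filter (1 ≤?_) l))

∅ₚ : Partition
∅ₚ = toPartition []

[_]ₚ : ℕ → Partition
[ n ]ₚ = toPartition (n ∷ [])

_⊔ₚ_ : Partition → Partition → Partition
λ' ⊔ₚ μ = toPartition (parts λ' ++ parts μ)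

size : Partition → ℕ
size λ' = sum (parts λ')

_≟ₚ_ : (λ' μ : Partition) → Dec (parts λ' ≡ parts μ)
λ' ≟ₚ μ = LP.≡-dec ℕ._≟_ (parts λ') (parts μ)

multiplicity : ℕ → Partition → ℕ
multiplicity i λ' = length (filter (ℕ._≟ i) (parts λ'))

-- ∏_i r_i(λ)!   (so that  m̃_λ = factor λ · m_λ)
factor : Partition → ℕ
factor λ' = foldr (λ i acc → (multiplicity i λ' ℕ.!) ℕ.* acc) 1 (upTo (suc (size λ')))

-- all weakly increasing lists of integers ≥ lo summing to n (fuel f)
incLists : ℕ → ℕ → ℕ → List (List ℕ)
incLists _       _  zero    = [] ∷ []
incLists zero    _  (suc n) = []
incLists (suc f) lo (suc n) =
  concatMap (λ k → if ⌊ lo ≤? k ⌋ ∧ ⌊ 1 ≤? k ⌋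
                   then map (k ∷_) (incLists f k (suc n ∸ k)) else [])
            (upTo (suc (suc n)))

partitionsOf : ℕ → List Partition
partitionsOf n = map toPartition (incLists n 1 n)

record WGraph : Set where
  field
    n      : ℕ
    adj    : Fin n → Fin n → Bool
    symm   : ∀ u v → adj u v ≡ adj v u
    irrefl : ∀ v → adj v v ≡ false
    w      : Fin n → ℕ
    w-pos  : ∀ v → 1 ≤ w v
open WGraph public

allFuns : ∀ n k → List (Fin n → Fin k)
allFuns zero    k = (λ ()) ∷ []
allFuns (suc n) k =
  concatMap (λ c → map (λ f → λ { F.zero → c ; (F.suc i) → f i }) (allFuns n k)) (allFin k)

count : ∀ {A : Set} → (A → Bool) → List A → ℕ
count p xs = length (filter (λ x → T? (p x)) xs)
  where
  T? : (b : Bool) → Dec (T b)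
  T? true  = yes _
  T? false = no (λ ())

totalWeight : WGraph → ℕ
totalWeight G = sum (map (w G) (allFin (n G)))

isProper : (G : WGraph) {k : ℕ} → (Fin (n G) → Fin k) → Bool
isProper G κ = allB (λ u → allB (λ v → not (adj G u v) ∨ not ⌊ κ u F.≟ κ v ⌋) (allFin (n G))) (allFin (n G))

classWeight : (G : WGraph) {k : ℕ} → (Fin (n G) → Fin k) → Fin k → ℕ
classWeight G κ i = sum (map (w G) (filter (λ v → κ v F.≟ i) (allFin (n G))))

-- coefficient of m_λ in X_G = coefficient of the monomial
-- x_1^{λ_1} ⋯ x_ℓ^{λ_ℓ}, i.e. the number of proper colourings
-- κ : V → {1,…,ℓ} with Σ_{κ(v)=i} w(v) = λ_i for all i.
-- (Colours > ℓ cannot occur since all weights are ≥ 1.)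
coeffX : WGraph → Partition → ℕ
coeffX G λ' = count (λ κ → isProper G κ ∧
                        allB (λ i → ⌊ classWeight G κ i ℕ.≟ lookup (parts λ') i ⌋) (allFin _))
                    (allFuns (n G) (length (parts λ')))

-- Set partitions of V encoded by restricted growth functions
-- f : V → ℕ (block labels, blocks labelled 0,1,… in order of their least
-- vertex): f(v) ≤ 1 + max_{u<v} f(u)  (and f(0) = 0).
labelsBefore : ∀ {m} → (Fin m → Fin m) → Fin m → ℕ
labelsBefore f v = foldr ℕ._⊔_ 0 (map (λ u → if ⌊ toℕ u <? toℕ v ⌋ then suc (toℕ (f u)) else 0) (allFin _))

isRGF : ∀ {m} → (Fin m → Fin m) → Bool
isRGF f = allB (λ v → ⌊ toℕ (f v) ≤? labelsBefore f v ⌋) (allFin _)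

numBlocks : ∀ {m} → (Fin m → Fin m) → ℕ
numBlocks f = foldr ℕ._⊔_ 0 (map (λ u → suc (toℕ (f u))) (allFin _))

blocksStable : (G : WGraph) → (Fin (n G) → Fin (n G)) → Bool
blocksStable G f = isProper G f

blockWeights : (G : WGraph) → (Fin (n G) → Fin (n G)) → Partition
blockWeights G f = toPartition (map (λ b → sum (map (w G) (filter (λ v → toℕ (f v) ℕ.≟ b) (allFin (n G)))))
                                    (upTo (numBlocks f)))

numSt : WGraph → Partition → ℕ
numSt G λ' = count (λ f → isRGF f ∧ blocksStable G f ∧ ⌊ blockWeights G f ≟ₚ λ' ⌋)
                   (allFuns (n G) (n G))

module SymFun {c ℓ} (K : Field c ℓ) where
  open Field K
  open FieldOps K

  -- an element of Λ̃ = Λ, as a finite K-linear combination of the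
  -- monomial basis m_λ
  SF : Set c
  SF = List (Carrier × Partition)

  m̃ : Partition → SF
  m̃ λ' = (fromℕ (factor λ') , λ') ∷ []

  -- chromatic symmetric function X_G = Σ_{λ ⊢ |w|} coeffX G λ · m_λ
  -- (X_G is homogeneous of degree Σ_v w(v))
  X : WGraph → SF
  X G = map (λ λ' → fromℕ (coeffX G λ') , λ') (partitionsOf (totalWeight G))

  -- a linear functional Λ̃ → K, given by its values on the basis (m_λ)
  Functional : Set c
  Functional = Partition → Carrier

  ev : Functional → SF → Carrier
  ev ζ f = Σᴷ (map (λ p → proj₁ p * ζ (proj₂ p)) f)

  -- character: ζ(1) = 1 and ζ(f ⊙ g) = ζ(f) ζ(g); by bilinearity it
  -- suffices to ask it on the basis m̃, where m̃_λ ⊙ m̃_μ = m̃_{λ⊔μ}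
  -- (and 1 = m̃_∅).
  record IsCharacter (ζ : Functional) : Set (c ⊔ ℓ) where
    field
      unit : ev ζ (m̃ ∅ₚ) ≈ 1#
      mult : ∀ λ' μ → ev ζ (m̃ (λ' ⊔ₚ μ)) ≈ ev ζ (m̃ λ') * ev ζ (m̃ μ)

  Character : Set (c ⊔ ℓ)
  Character = Σ Functional IsCharacter

  -- coproduct of Λ on the monomial basis:
  -- Δ m_λ = Σ_{(μ,ν) : μ ⊔ ν = λ} m_μ ⊗ m_ν
  Δpairs : Partition → List (Partition × Partition)
  Δpairs λ' = concatMap (λ k → concatMap (λ μ → concatMap (λ ν →
                 if ⌊ (μ ⊔ₚ ν) ≟ₚ λ' ⌋ then (μ , ν) ∷ [] else [])
                 (partitionsOf (size λ' ∸ k))) (partitionsOf k))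
              (upTo (suc (size λ')))

  -- convolution  (ζ * ξ)(f) = Σ ζ(f₁) ξ(f₂)
  _⋆_ : Functional → Functional → Functional
  (ζ ⋆ ξ) λ' = Σᴷ (map (λ p → ζ (proj₁ p) * ξ (proj₂ p)) (Δpairs λ'))

module Submission where

-- Since m̃_λ ⊙ m̃_μ = m̃_{λ⊔μ}, a character ζ satisfies ζ(m̃_λ) = a_{λ_1} ⋯ a_{λ_ℓ}, and
-- ζ(m̃_λ) = ∏ᵢ rᵢ(λ)! · ζ(m_λ) with ∏ᵢ rᵢ(λ)! invertible in characteristic 0; so ζ is determined by a,
-- and conversely ζ(m_λ) := a_{λ_1} ⋯ a_{λ_ℓ} / ∏ᵢ rᵢ(λ)! is a character for every a.
--
-- The coefficient of m_λ in X_G counts the proper colourings κ : V → {1, …, ℓ} whose colour classes have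
-- weights λ_1, …, λ_ℓ. Writing κ as a restricted growth function (a set partition of V into stable sets)
-- followed by an injective colouring of its blocks, the blocks must be coloured so that the block weights
-- land on equal parts of λ, which can be done in ∏ᵢ rᵢ(λ)! ways; hence ζ_a(X_G) = Σ_λ |St_λ(G)| a_λ.
--
-- For the convolution, ∏ (a_{λ_i} + b_{λ_i}) expands into a sum over the ways of splitting the parts of λ
-- into two sublists. A pair (μ, ν) with μ ⊔ ν = λ arises from ∏ᵢ rᵢ(λ)! / (∏ᵢ rᵢ(μ)! ∏ᵢ rᵢ(ν)!) splittings,
-- which is exactly the coefficient relating Δ m̃_λ to Σ_{μ⊔ν=λ} m̃_μ ⊗ m̃_ν.

open import Defs
open import Level using (Level)
open import Data.Nat using (ℕ; _≤_)
open import Data.List using (map)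
open import Data.Product using (Σ; _×_; _,_; proj₁)

module Sums where
  open import Algebra.Bundles using (CommutativeSemiring)
  open import Data.Bool using (Bool; true; false; T; _∧_; if_then_else_)
  open import Data.Empty using (⊥-elim)
  open import Data.List using (List; []; _∷_; _++_; map; foldr; concatMap; filter)
  open import Data.List.Membership.Propositional using (_∈_; _∉_)
  open import Data.List.Relation.Binary.Permutation.Propositional using (_↭_; ↭-refl; ↭-trans; ↭-prep)
  import Data.List.Relation.Binary.Permutation.Propositional.Properties as ↭
  open import Data.List.Relation.Unary.All as All using (All; []; _∷_)
  import Data.List.Relation.Unary.All.Properties as All
  open import Data.List.Relation.Unary.Any using (here; there)
  open import Data.List.Relation.Unary.Unique.Propositional using (Unique; []; _∷_)
  open import Data.Product using (_×_; _,_; proj₁; proj₂; map₁; map₂)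
  open import Function using (_∘_; _⇔_; mk⇔; Equivalence)
  open import Relation.Binary.Definitions using (DecidableEquality)
  open import Relation.Binary.PropositionalEquality as ≡ using (_≡_; _≢_)
  open import Relation.Nullary using (Dec; yes; no; ¬_)
  open import Relation.Nullary.Decidable using (⌊_⌋)
  open import Relation.Unary using (Decidable)

  ⌊⌋-⇔ : ∀ {a b} {A : Set a} {B : Set b} → A ⇔ B → (a? : Dec A) (b? : Dec B) → ⌊ a? ⌋ ≡ ⌊ b? ⌋
  ⌊⌋-⇔ A⇔B (yes a) (yes b) = ≡.refl
  ⌊⌋-⇔ A⇔B (no ¬a) (no ¬b) = ≡.refl
  ⌊⌋-⇔ A⇔B (yes a) (no ¬b) = ⊥-elim (¬b (Equivalence.to A⇔B a))
  ⌊⌋-⇔ A⇔B (no ¬a) (yes b) = ⊥-elim (¬a (Equivalence.from A⇔B b))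

  ⌊⌋-yes : ∀ {a} {A : Set a} (a? : Dec A) → A → ⌊ a? ⌋ ≡ true
  ⌊⌋-yes (yes _) _ = ≡.refl
  ⌊⌋-yes (no ¬a) a = ⊥-elim (¬a a)

  ⌊⌋-no : ∀ {a} {A : Set a} (a? : Dec A) → ¬ A → ⌊ a? ⌋ ≡ false
  ⌊⌋-no (no _)  _  = ≡.refl
  ⌊⌋-no (yes a) ¬a = ⊥-elim (¬a a)

  T-injective : ∀ {a b} → (T a → T b) → (T b → T a) → a ≡ b
  T-injective {false} {false} _  _    = ≡.refl
  T-injective {true}  {true}  _  _    = ≡.refl
  T-injective {true}  {false} to _    = ⊥-elim (to _)
  T-injective {false} {true}  _  from = ⊥-elim (from _)

  splits : ∀ {a} {A : Set a} → List A → List (List A × List A)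
  splits []       = ([] , []) ∷ []
  splits (x ∷ xs) = map (map₁ (x ∷_)) (splits xs) ++ map (map₂ (x ∷_)) (splits xs)

  splits-↭ : ∀ {a} {A : Set a} (xs : List A) → All (λ s → proj₁ s ++ proj₂ s ↭ xs) (splits xs)
  splits-↭ []       = ↭-refl ∷ []
  splits-↭ (x ∷ xs) = All.++⁺
    (All.map⁺ (All.map (↭-prep x) (splits-↭ xs)))
    (All.map⁺ (All.map (λ {s} p → ↭-trans (↭.shift x (proj₁ s) (proj₂ s)) (↭-prep x p)) (splits-↭ xs)))

  module Sum {c ℓ} (R : CommutativeSemiring c ℓ) where
    open CommutativeSemiring R
    open import Relation.Binary.Reasoning.Setoid setoid

    ∑ : ∀ {a} {A : Set a} → List A → (A → Carrier) → Carrier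
    ∑ xs f = foldr _+_ 0# (map f xs)

    syntax ∑ xs (λ x → e) = ∑[ x ← xs ] e

    ∏ : ∀ {a} {A : Set a} → List A → (A → Carrier) → Carrier
    ∏ xs f = foldr _*_ 1# (map f xs)

    when : Bool → Carrier → Carrier
    when b x = if b then x else 0#

    when-∧ : ∀ b b′ x → when (b ∧ b′) x ≡ when b (when b′ x)
    when-∧ true  _ _ = ≡.refl
    when-∧ false _ _ = ≡.refl

    when-comm : ∀ b b′ x → when b (when b′ x) ≡ when b′ (when b x)
    when-comm true  _     _ = ≡.refl
    when-comm false true  _ = ≡.refl
    when-comm false false _ = ≡.refl

    when-*ʳ : ∀ b x → when b x ≈ when b 1# * x
    when-*ʳ true  x = sym (*-identityˡ x)
    when-*ʳ false x = sym (zeroˡ x)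

    when-zero : ∀ b → when b 0# ≈ 0#
    when-zero true  = refl
    when-zero false = refl

    *-when : ∀ k b x → k * when b x ≈ when b (k * x)
    *-when k true  x = refl
    *-when k false x = zeroʳ k

    module _ {a} {A : Set a} where

      ∑-cong : ∀ (xs : List A) {f g : A → Carrier} → (∀ x → f x ≈ g x) → ∑ xs f ≈ ∑ xs g
      ∑-cong []       f≈g = refl
      ∑-cong (x ∷ xs) f≈g = +-cong (f≈g x) (∑-cong xs f≈g)

      ∑-congᴬ : ∀ {p} {P : A → Set p} {xs : List A} {f g : A → Carrier} →
                All P xs → (∀ x → P x → f x ≈ g x) → ∑ xs f ≈ ∑ xs g
      ∑-congᴬ []         f≈g = refl
      ∑-congᴬ (px ∷ pxs) f≈g = +-cong (f≈g _ px) (∑-congᴬ pxs f≈g)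

      ∑-++ : ∀ (xs ys : List A) f → ∑ (xs ++ ys) f ≈ ∑ xs f + ∑ ys f
      ∑-++ []       ys f = sym (+-identityˡ _)
      ∑-++ (x ∷ xs) ys f = trans (+-congˡ (∑-++ xs ys f)) (sym (+-assoc _ _ _))

      ∑-zero : ∀ (xs : List A) → ∑[ _ ← xs ] 0# ≈ 0#
      ∑-zero []       = refl
      ∑-zero (x ∷ xs) = trans (+-identityˡ _) (∑-zero xs)

      ∑-distrib-+ : ∀ (xs : List A) f g → ∑[ x ← xs ] (f x + g x) ≈ ∑ xs f + ∑ xs g
      ∑-distrib-+ []       f g = sym (+-identityˡ _)
      ∑-distrib-+ (x ∷ xs) f g =
        trans (+-congˡ (∑-distrib-+ xs f g)) (interchange (f x) (g x) (∑ xs f) (∑ xs g))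
        where open import Algebra.Properties.CommutativeSemigroup +-commutativeSemigroup using (interchange)

      *-distribˡ-∑ : ∀ (xs : List A) k f → k * ∑ xs f ≈ ∑[ x ← xs ] (k * f x)
      *-distribˡ-∑ []       k f = zeroʳ k
      *-distribˡ-∑ (x ∷ xs) k f = trans (distribˡ _ _ _) (+-congˡ (*-distribˡ-∑ xs k f))

      *-distribʳ-∑ : ∀ (xs : List A) k f → ∑ xs f * k ≈ ∑[ x ← xs ] (f x * k)
      *-distribʳ-∑ xs k f = trans (*-comm _ _) (trans (*-distribˡ-∑ xs k f) (∑-cong xs λ _ → *-comm _ _))

      ∑-if-[] : ∀ b (xs : List A) f → ∑ (if b then xs else []) f ≈ when b (∑ xs f)
      ∑-if-[] true  xs f = refl
      ∑-if-[] false xs f = refl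

      ∑-filter : ∀ {p} {P : A → Set p} (P? : Decidable P) xs f → ∑ (filter P? xs) f ≈ ∑[ x ← xs ] when ⌊ P? x ⌋ (f x)
      ∑-filter P? []       f = refl
      ∑-filter P? (x ∷ xs) f with P? x
      ... | yes _ = +-congˡ (∑-filter P? xs f)
      ... | no  _ = trans (∑-filter P? xs f) (sym (+-identityˡ _))

      when-∑ : ∀ b (xs : List A) f → when b (∑ xs f) ≈ ∑[ x ← xs ] when b (f x)
      when-∑ true  xs f = refl
      when-∑ false xs f = sym (∑-zero xs)

    module _ {a b} {A : Set a} {B : Set b} where

      ∑-map : ∀ (xs : List A) (g : A → B) f → ∑ (map g xs) f ≡ ∑[ x ← xs ] f (g x)
      ∑-map []       g f = ≡.refl
      ∑-map (x ∷ xs) g f = ≡.cong (f (g x) +_) (∑-map xs g f)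

      ∑-concatMap : ∀ (xs : List A) (g : A → List B) f → ∑ (concatMap g xs) f ≈ ∑[ x ← xs ] ∑ (g x) f
      ∑-concatMap []       g f = refl
      ∑-concatMap (x ∷ xs) g f = trans (∑-++ (g x) (concatMap g xs) f) (+-congˡ (∑-concatMap xs g f))

      ∑-comm : ∀ (xs : List A) (ys : List B) (f : A → B → Carrier) →
               ∑[ x ← xs ] ∑ ys (f x) ≈ ∑[ y ← ys ] ∑[ x ← xs ] f x y
      ∑-comm []       ys f = sym (∑-zero ys)
      ∑-comm (x ∷ xs) ys f = trans (+-congˡ (∑-comm xs ys f)) (sym (∑-distrib-+ ys (f x) _))

    module _ {a} {A : Set a} (_≟_ : DecidableEquality A) where
      open import Data.List.Membership.DecPropositional _≟_ using (_∈?_)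

      when-≟ : ∀ (g : A → Carrier) {x y} → when ⌊ x ≟ y ⌋ (g x) ≈ when ⌊ x ≟ y ⌋ (g y)
      when-≟ g {x} {y} with x ≟ y
      ... | yes ≡.refl = refl
      ... | no  _      = refl

      ∑-δ-∉ : ∀ {x xs} (g : A → Carrier) → x ∉ xs → ∑[ y ← xs ] when ⌊ y ≟ x ⌋ (g y) ≈ 0#
      ∑-δ-∉ {x} {[]}     g x∉ = refl
      ∑-δ-∉ {x} {y ∷ ys} g x∉ with y ≟ x
      ... | yes ≡.refl = ⊥-elim (x∉ (here ≡.refl))
      ... | no  _    = trans (+-identityˡ _) (∑-δ-∉ g (x∉ ∘ there))

      ∑-δ : ∀ {x xs} (g : A → Carrier) → Unique xs → x ∈ xs → ∑[ y ← xs ] when ⌊ y ≟ x ⌋ (g y) ≈ g x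
      ∑-δ {x} {y ∷ ys} g (y∉ys ∷ !ys) x∈ with y ≟ x
      ... | yes ≡.refl = trans (+-congˡ (∑-δ-∉ g (λ y∈ys → All.lookup y∉ys y∈ys ≡.refl))) (+-identityʳ _)
      ∑-δ {x} {y ∷ ys} g (y∉ys ∷ !ys) (here ≡.refl) | no y≢x = ⊥-elim (y≢x ≡.refl)
      ∑-δ {x} {y ∷ ys} g (y∉ys ∷ !ys) (there x∈ys)  | no y≢x = trans (+-identityˡ _) (∑-δ g !ys x∈ys)

      ≟-sym : ∀ x y → ⌊ x ≟ y ⌋ ≡ ⌊ y ≟ x ⌋
      ≟-sym x y = ⌊⌋-⇔ (mk⇔ ≡.sym ≡.sym) (x ≟ y) (y ≟ x)

      ∑-δ′ : ∀ {x xs} (g : A → Carrier) → Unique xs → x ∈ xs → ∑[ y ← xs ] when ⌊ x ≟ y ⌋ (g y) ≈ g x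
      ∑-δ′ {x} {xs} g !xs x∈ = trans (∑-cong xs λ y → reflexive (≡.cong (λ b → when b (g y)) (≟-sym x y))) (∑-δ g !xs x∈)

      ∑-∈? : ∀ {xs ps} (g : A → Carrier) → Unique xs → Unique ps → (∀ {p} → p ∈ ps → p ∈ xs) →
             ∑[ x ← xs ] when ⌊ x ∈? ps ⌋ (g x) ≈ ∑ ps g
      ∑-∈? {xs} {[]}     g !xs !ps ps⊆xs = ∑-zero xs
      ∑-∈? {xs} {p ∷ ps} g !xs (p∉ps ∷ !ps) ps⊆xs = begin
        ∑[ x ← xs ] when ⌊ x ∈? p ∷ ps ⌋ (g x)                                ≈⟨ ∑-cong xs split ⟩
        ∑[ x ← xs ] (when ⌊ x ≟ p ⌋ (g x) + when ⌊ x ∈? ps ⌋ (g x))           ≈⟨ ∑-distrib-+ xs _ _ ⟩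
        ∑[ x ← xs ] when ⌊ x ≟ p ⌋ (g x) + ∑[ x ← xs ] when ⌊ x ∈? ps ⌋ (g x)
          ≈⟨ +-cong (∑-δ g !xs (ps⊆xs (here ≡.refl))) (∑-∈? g !xs !ps (ps⊆xs ∘ there)) ⟩
        g p + ∑ ps g                                                          ∎
        where
        split : ∀ x → when ⌊ x ∈? p ∷ ps ⌋ (g x) ≈ when ⌊ x ≟ p ⌋ (g x) + when ⌊ x ∈? ps ⌋ (g x)
        split x with x ≟ p | x ∈? ps
        ... | no  _      | no  _    = sym (+-identityˡ _)
        ... | no  _      | yes _    = sym (+-identityˡ _)
        ... | yes _      | no  _    = sym (+-identityʳ _)
        ... | yes ≡.refl | yes x∈ps = ⊥-elim (All.lookup p∉ps x∈ps ≡.refl)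

    ∏-+ : ∀ {a} {A : Set a} (f g : A → Carrier) (xs : List A) →
          ∏ xs (λ x → f x + g x) ≈ ∑[ s ← splits xs ] (∏ (proj₁ s) f * ∏ (proj₂ s) g)
    ∏-+ f g []       = sym (trans (+-identityʳ _) (*-identityˡ 1#))
    ∏-+ {A = A} f g (x ∷ xs) = begin
      (f x + g x) * ∏ xs (λ x → f x + g x)                 ≈⟨ *-congˡ (∏-+ f g xs) ⟩
      (f x + g x) * ∑ (splits xs) term                     ≈⟨ distribʳ _ (f x) (g x) ⟩
      f x * ∑ (splits xs) term + g x * ∑ (splits xs) term  ≈⟨ +-cong (*-distribˡ-∑ (splits xs) (f x) term) (*-distribˡ-∑ (splits xs) (g x) term) ⟩
      ∑[ s ← splits xs ] (f x * term s) + ∑[ s ← splits xs ] (g x * term s)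
        ≈⟨ +-cong (∑-cong (splits xs) λ s → sym (*-assoc (f x) _ _)) (∑-cong (splits xs) λ s → x∙yz≈y∙xz (g x) _ _) ⟩
      ∑[ s ← splits xs ] term (map₁ (x ∷_) s) + ∑[ s ← splits xs ] term (map₂ (x ∷_) s)
        ≈⟨ +-cong (reflexive (∑-map (splits xs) (map₁ (x ∷_)) term)) (reflexive (∑-map (splits xs) (map₂ (x ∷_)) term)) ⟨
      ∑ (map (map₁ (x ∷_)) (splits xs)) term + ∑ (map (map₂ (x ∷_)) (splits xs)) term
        ≈⟨ ∑-++ (map (map₁ (x ∷_)) (splits xs)) _ term ⟨
      ∑ (splits (x ∷ xs)) term ∎
      where
      open import Algebra.Properties.CommutativeSemigroup *-commutativeSemigroup using (x∙yz≈y∙xz)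
      term : List A × List A → Carrier
      term s = ∏ (proj₁ s) f * ∏ (proj₂ s) g

    ∑-fibres : ∀ {a b} {A : Set a} {B : Set b} (_≟_ : DecidableEquality B) (img : A → B) {xs : List A} (ys : List B) →
               All (λ x → ∑[ y ← ys ] when ⌊ img x ≟ y ⌋ 1# ≈ 1#) xs →
               ∀ g → ∑ xs g ≈ ∑[ y ← ys ] ∑[ x ← xs ] when ⌊ img x ≟ y ⌋ (g x)
    ∑-fibres _≟_ img {xs} ys once g = begin
      ∑ xs g                                                   ≈⟨ ∑-congᴬ once (λ x once-x → trans (sym (*-identityˡ (g x))) (*-congʳ (sym once-x))) ⟩
      ∑[ x ← xs ] ((∑[ y ← ys ] when ⌊ img x ≟ y ⌋ 1#) * g x)
        ≈⟨ ∑-cong xs (λ x → trans (*-distribʳ-∑ ys (g x) _) (∑-cong ys λ y → sym (when-*ʳ _ (g x)))) ⟩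
      ∑[ x ← xs ] ∑[ y ← ys ] when ⌊ img x ≟ y ⌋ (g x)          ≈⟨ ∑-comm xs ys _ ⟩
      ∑[ y ← ys ] ∑[ x ← xs ] when ⌊ img x ≟ y ⌋ (g x)          ∎

module Multisets where
  open Sums
  open import Data.Empty using (⊥-elim)
  open import Data.List using (List; []; _∷_; _++_; map; filter; length; foldr; upTo)
  open import Data.List.Membership.Propositional using (_∈_; _∉_)
  open import Data.List.Membership.Propositional.Properties using (∈-upTo⁻)
  import Data.List.Properties as LP
  open import Data.List.Relation.Binary.Equality.Propositional using (≋⇒≡)
  open import Data.List.Relation.Binary.Permutation.Propositional
    using (_↭_; ↭-refl; ↭-sym; ↭-trans; ↭-prep; ↭-swap; ↭-reflexive; ↭⇒↭ₛ)
  import Data.List.Relation.Binary.Permutation.Propositional as Perm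
  import Data.List.Relation.Binary.Permutation.Propositional.Properties as ↭
  open import Data.List.Relation.Unary.All as All using (All; []; _∷_)
  import Data.List.Relation.Unary.All.Properties as All
  open import Data.List.Relation.Unary.Any using (here; there)
  open import Data.List.Relation.Unary.Linked using ([]; [-]; _∷_)
  import Data.List.Relation.Unary.Sorted.TotalOrder.Properties as SortedP
  open import Data.Nat as ℕ using (ℕ; suc; _+_; _*_; _≤_; _<_; _≤?_; _≟_; s≤s; _!)
  open import Data.Nat.ListAction using (sum)
  open import Data.Nat.ListAction.Properties using (sum-++; sum-↭)
  import Data.Nat.Properties as ℕP
  open import Data.Product using (∃; _,_)
  open import Function using (_∘_; _⇔_; mk⇔)
  open import Relation.Binary.PropositionalEquality
    using (_≡_; _≢_; refl; cong; cong₂; sym; trans; subst; module ≡-Reasoning)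
  open import Relation.Nullary using (Dec; yes; no)
  open import Relation.Nullary.Decidable using (recompute; map′; ⌊_⌋)
  import Algebra.Properties.CommutativeSemigroup ℕP.*-commutativeSemigroup as ℕ*
  open import Data.List.Membership.DecPropositional ℕ._≟_ using () renaming (_∈?_ to _∈ℕ?_)
  open import Data.List.Relation.Unary.Sorted.TotalOrder ℕP.≤-totalOrder using (Sorted)
  import Data.List.Relation.Unary.Sorted.TotalOrder ℕP.≤-totalOrder as Sorted
  open import Data.List.Sort.Base ℕP.≤-totalOrder using (SortingAlgorithm)
  open import Data.List.Sort.MergeSort ℕP.≤-decTotalOrder using (mergeSort)
  open SortingAlgorithm mergeSort using (sort; sort-↭; sort-↗)
  open Sum ℕP.+-*-commutativeSemiring

  occ : ℕ → List ℕ → ℕ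
  occ x xs = length (filter (_≟ x) xs)

  occ-↭ : ∀ x {xs ys} → xs ↭ ys → occ x xs ≡ occ x ys
  occ-↭ x xs↭ys = ↭.↭-length (↭.filter-↭ (_≟ x) xs↭ys)

  occ-here : ∀ x xs → occ x (x ∷ xs) ≡ suc (occ x xs)
  occ-here x xs = cong length (LP.filter-accept (_≟ x) {x} {xs} refl)

  occ-there : ∀ {x y} xs → y ≢ x → occ x (y ∷ xs) ≡ occ x xs
  occ-there {x} {y} xs y≢x = cong length (LP.filter-reject (_≟ x) {y} {xs} y≢x)

  occ-++ : ∀ x xs ys → occ x (xs ++ ys) ≡ occ x xs + occ x ys
  occ-++ x xs ys = trans (cong length (LP.filter-++ (_≟ x) xs ys)) (LP.length-++ (filter (_≟ x) xs))

  occ-∉ : ∀ {x xs} → x ∉ xs → occ x xs ≡ 0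
  occ-∉ {x} {[]}     x∉ = refl
  occ-∉ {x} {y ∷ ys} x∉ with y ≟ x
  ... | yes refl = ⊥-elim (x∉ (here refl))
  ... | no  y≢x  = trans (occ-there ys y≢x) (occ-∉ (x∉ ∘ there))

  occ-upTo : ∀ {x B} → x < B → occ x (upTo B) ≡ 1
  occ-upTo {x} {suc B} x<1+B = begin
    occ x (upTo (suc B))              ≡⟨ cong (occ x) (LP.upTo-∷ʳ B) ⟨
    occ x (upTo B ++ B ∷ [])          ≡⟨ occ-++ x (upTo B) (B ∷ []) ⟩
    occ x (upTo B) + occ x (B ∷ [])   ≡⟨ split (B ≟ x) ⟩
    1                                 ∎
    where
    open ≡-Reasoning
    split : Dec (B ≡ x) → occ x (upTo B) + occ x (B ∷ []) ≡ 1
    split (yes refl) = cong₂ _+_ (occ-∉ {xs = upTo x} (ℕP.<-irrefl refl ∘ ∈-upTo⁻)) (occ-here x [])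
    split (no B≢x)   = cong₂ _+_ (occ-upTo (ℕP.≤∧≢⇒< (ℕP.≤-pred x<1+B) (B≢x ∘ sym))) (occ-there [] B≢x)

  listFactor : List ℕ → ℕ
  listFactor []       = 1
  listFactor (x ∷ xs) = suc (occ x xs) * listFactor xs

  listFactor-swap : ∀ x y zs → listFactor (x ∷ y ∷ zs) ≡ listFactor (y ∷ x ∷ zs)
  listFactor-swap x y zs with x ≟ y
  ... | yes refl = refl
  ... | no  x≢y  = begin
    suc (occ x (y ∷ zs)) * (suc (occ y zs) * listFactor zs)
      ≡⟨ cong (λ k → suc k * _) (occ-there zs (x≢y ∘ sym)) ⟩
    suc (occ x zs) * (suc (occ y zs) * listFactor zs)
      ≡⟨ ℕ*.x∙yz≈y∙xz (suc (occ x zs)) (suc (occ y zs)) (listFactor zs) ⟩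
    suc (occ y zs) * (suc (occ x zs) * listFactor zs)
      ≡⟨ cong (λ k → suc k * _) (occ-there zs x≢y) ⟨
    suc (occ y (x ∷ zs)) * (suc (occ x zs) * listFactor zs) ∎
    where open ≡-Reasoning

  listFactor-∷ : ∀ x {xs ys} → xs ↭ ys → listFactor xs ≡ listFactor ys → listFactor (x ∷ xs) ≡ listFactor (x ∷ ys)
  listFactor-∷ x p = cong₂ (λ k m → suc k * m) (occ-↭ x p)

  listFactor-↭ : ∀ {xs ys} → xs ↭ ys → listFactor xs ≡ listFactor ys
  listFactor-↭ Perm.refl         = refl
  listFactor-↭ (Perm.prep x p)   = listFactor-∷ x p (listFactor-↭ p)
  listFactor-↭ (Perm.swap x y p) =
    trans (listFactor-swap x y _) (listFactor-∷ y (↭-prep x p) (listFactor-∷ x p (listFactor-↭ p)))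
  listFactor-↭ (Perm.trans p q)  = trans (listFactor-↭ p) (listFactor-↭ q)

  listFactor-nonZero : ∀ xs → ∃ λ k → listFactor xs ≡ suc k
  listFactor-nonZero []       = 0 , refl
  listFactor-nonZero (x ∷ xs) with listFactor-nonZero xs
  ... | k , eq = k + occ x xs * suc k , cong (suc (occ x xs) *_) eq

  delete : ℕ → List ℕ → List ℕ
  delete x []       = []
  delete x (y ∷ ys) with x ≟ y
  ... | yes _ = ys
  ... | no  _ = y ∷ delete x ys

  delete-↭ : ∀ {x xs} → x ∈ xs → xs ↭ x ∷ delete x xs
  delete-↭ {x} {y ∷ ys} x∈ with x ≟ y
  delete-↭ {x} {y ∷ ys} x∈          | yes refl = ↭-refl
  delete-↭ {x} {y ∷ ys} (here refl) | no  x≢y  = ⊥-elim (x≢y refl)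
  delete-↭ {x} {y ∷ ys} (there x∈)  | no  x≢y  = ↭-trans (↭-prep y (delete-↭ x∈)) (↭-swap y x ↭-refl)

  listFactor-delete : ∀ {x xs} → x ∈ xs → listFactor xs ≡ occ x xs * listFactor (delete x xs)
  listFactor-delete {x} {xs} x∈ = begin
    listFactor xs                                      ≡⟨ listFactor-↭ (delete-↭ x∈) ⟩
    suc (occ x (delete x xs)) * listFactor (delete x xs) ≡⟨ cong (_* listFactor (delete x xs)) (occ-here x _) ⟨
    occ x (x ∷ delete x xs) * listFactor (delete x xs)   ≡⟨ cong (_* listFactor (delete x xs)) (occ-↭ x (delete-↭ x∈)) ⟨
    occ x xs * listFactor (delete x xs)                  ∎
    where open ≡-Reasoning

  productOf : (ℕ → ℕ) → List ℕ → ℕ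
  productOf g = foldr (λ i acc → g i * acc) 1

  productOf-cong-absent : ∀ x {g h} is → (∀ i → i ≢ x → g i ≡ h i) → occ x is ≡ 0 → productOf g is ≡ productOf h is
  productOf-cong-absent x []       g≗h occ≡0 = refl
  productOf-cong-absent x (i ∷ is) g≗h occ≡0 with i ≟ x
  ... | yes refl = ⊥-elim (ℕP.0≢1+n (trans (sym occ≡0) (occ-here i is)))
  ... | no  i≢x  = cong₂ _*_ (g≗h i i≢x) (productOf-cong-absent x is g≗h (trans (sym (occ-there is i≢x)) occ≡0))

  productOf-unique : ∀ x c {g h} is → (∀ i → i ≢ x → g i ≡ h i) → g x ≡ c * h x → occ x is ≡ 1 →
             productOf g is ≡ c * productOf h is
  productOf-unique x c         []       g≗h gx occ≡1 = ⊥-elim (ℕP.0≢1+n occ≡1)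
  productOf-unique x c {g} {h} (i ∷ is) g≗h gx occ≡1 with i ≟ x
  ... | yes refl = begin
    g i * productOf g is       ≡⟨ cong₂ _*_ gx (productOf-cong-absent i is g≗h (ℕP.suc-injective (trans (sym (occ-here i is)) occ≡1))) ⟩
    c * h i * productOf h is   ≡⟨ ℕP.*-assoc c _ _ ⟩
    c * (h i * productOf h is) ∎
    where open ≡-Reasoning
  ... | no i≢x = begin
    g i * productOf g is       ≡⟨ cong₂ _*_ (g≗h i i≢x) (productOf-unique x c is g≗h gx (trans (sym (occ-there is i≢x)) occ≡1)) ⟩
    h i * (c * productOf h is) ≡⟨ ℕ*.x∙yz≈y∙xz (h i) c _ ⟩
    c * (h i * productOf h is) ∎
    where open ≡-Reasoning

  productOf-occ! : ∀ B xs → All (_< B) xs → productOf (λ i → occ i xs !) (upTo B) ≡ listFactor xs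
  productOf-occ! B []       []           = productOf-ones (upTo B)
    where
    productOf-ones : ∀ is → productOf (λ _ → 1) is ≡ 1
    productOf-ones []       = refl
    productOf-ones (i ∷ is) = trans (ℕP.+-identityʳ _) (productOf-ones is)
  productOf-occ! B (x ∷ xs) (x<B ∷ xs<B) = trans
    (productOf-unique x (suc (occ x xs)) (upTo B)
       (λ i i≢x → cong _! (occ-there xs (i≢x ∘ sym))) (cong _! (occ-here x xs)) (occ-upTo x<B))
    (cong (suc (occ x xs) *_) (productOf-occ! B xs xs<B))

  factor≡listFactor : ∀ λ' → factor λ' ≡ listFactor (parts λ')
  factor≡listFactor λ' = productOf-occ! (suc (size λ')) (parts λ') (All.map s≤s (≤-sum (parts λ')))
    where
    ≤-sum : ∀ xs → All (_≤ sum xs) xs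
    ≤-sum []       = []
    ≤-sum (x ∷ xs) = ℕP.m≤m+n x (sum xs) ∷ All.map (λ y≤ → ℕP.≤-trans y≤ (ℕP.m≤n+m (sum xs) x)) (≤-sum xs)

  sorted-↭⇒≡ : ∀ {xs ys} → Sorted xs → Sorted ys → xs ↭ ys → xs ≡ ys
  sorted-↭⇒≡ sxs sys xs↭ys = ≋⇒≡ (SortedP.↗↭↗⇒≋ ℕP.≤-totalOrder sxs sys (↭⇒↭ₛ xs↭ys))

  sort-sorted : ∀ {xs} → Sorted xs → sort xs ≡ xs
  sort-sorted {xs} sxs = sorted-↭⇒≡ (sort-↗ xs) sxs (sort-↭ xs)

  sort-cong : ∀ {xs ys} → xs ↭ ys → sort xs ≡ sort ys
  sort-cong {xs} {ys} xs↭ys =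
    sorted-↭⇒≡ (sort-↗ xs) (sort-↗ ys) (↭-trans (sort-↭ xs) (↭-trans xs↭ys (↭-sym (sort-↭ ys))))

  sort-injective : ∀ {xs ys} → sort xs ≡ sort ys → xs ↭ ys
  sort-injective {xs} {ys} eq = ↭-trans (↭-sym (sort-↭ xs)) (subst (_↭ ys) (sym eq) (sort-↭ ys))

  infix 4 _↭?_
  opaque
    _↭?_ : (xs ys : List ℕ) → Dec (xs ↭ ys)
    xs ↭? ys = map′ sort-injective sort-cong (LP.≡-dec _≟_ (sort xs) (sort ys))

  parts-sorted : ∀ λ' → Sorted (parts λ')
  parts-sorted (mkP ps s _) = recompute (Sorted.sorted? ℕ._≤?_ ps) s

  parts-pos : ∀ λ' → All (1 ≤_) (parts λ')
  parts-pos (mkP ps _ a) = recompute (All.all? (1 ≤?_) ps) a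

  parts-injective : ∀ {λ' μ} → parts λ' ≡ parts μ → λ' ≡ μ
  parts-injective {mkP ps _ _} {mkP .ps _ _} refl = refl

  parts-toPartition : ∀ {xs} → Sorted xs → All (1 ≤_) xs → parts (toPartition xs) ≡ xs
  parts-toPartition sxs pos = trans (cong sort (LP.filter-all (1 ≤?_) pos)) (sort-sorted sxs)

  parts-toPartition-↭ : ∀ {xs} → All (1 ≤_) xs → parts (toPartition xs) ↭ xs
  parts-toPartition-↭ {xs} pos = ↭-trans (sort-↭ _) (↭-reflexive (LP.filter-all (1 ≤?_) pos))

  toPartition-parts : ∀ λ' → toPartition (parts λ') ≡ λ'
  toPartition-parts λ' = parts-injective (parts-toPartition (parts-sorted λ') (parts-pos λ'))

  parts-[_]ₚ : ∀ {n} → 1 ≤ n → parts [ n ]ₚ ≡ n ∷ []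
  parts-[_]ₚ 1≤n = parts-toPartition [-] (1≤n ∷ [])

  parts-⊔ : ∀ λ' μ → parts (λ' ⊔ₚ μ) ↭ parts λ' ++ parts μ
  parts-⊔ λ' μ = parts-toPartition-↭ (All.++⁺ (parts-pos λ') (parts-pos μ))

  size-⊔ : ∀ λ' μ → size (λ' ⊔ₚ μ) ≡ size λ' + size μ
  size-⊔ λ' μ = trans (sum-↭ (parts-⊔ λ' μ)) (sum-++ (parts λ') (parts μ))

  toPartition-∷ : ∀ {x xs} → 1 ≤ x → All (1 ≤_) xs → toPartition (x ∷ xs) ≡ [ x ]ₚ ⊔ₚ toPartition xs
  toPartition-∷ {x} {xs} 1≤x pxs = parts-injective (sorted-↭⇒≡ (parts-sorted (toPartition (x ∷ xs))) (parts-sorted ([ x ]ₚ ⊔ₚ toPartition xs))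
    (↭-trans (parts-toPartition-↭ (1≤x ∷ pxs))
      (↭-sym (↭-trans (parts-⊔ [ x ]ₚ (toPartition xs))
        (↭.++⁺ (↭-reflexive parts-[ 1≤x ]ₚ) (parts-toPartition-↭ pxs))))))

  parts-toPartition≡⇔↭ : ∀ {xs} → All (1 ≤_) xs → ∀ λ' → (parts (toPartition xs) ≡ parts λ') ⇔ (xs ↭ parts λ')
  parts-toPartition≡⇔↭ {xs} pos λ' = mk⇔
    (λ eq → ↭-trans (↭-sym (parts-toPartition-↭ pos)) (↭-reflexive eq))
    (λ xs↭ → sorted-↭⇒≡ (parts-sorted (toPartition xs)) (parts-sorted λ') (↭-trans (parts-toPartition-↭ pos) xs↭))

  occ-map : ∀ {A : Set} (L : A → ℕ) c ys → occ c (map L ys) ≡ ∑[ q ← ys ] when ⌊ L q ≟ c ⌋ 1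
  occ-map L c []       = refl
  occ-map L c (y ∷ ys) with L y ≟ c
  ... | yes refl = trans (occ-here (L y) (map L ys)) (cong suc (occ-map L (L y) ys))
  ... | no  Ly≢c = trans (occ-there (map L ys) Ly≢c) (occ-map L c ys)

  -- the number of bijections between the positions of ys and of us that preserve the entries
  matchings : List ℕ → List ℕ → ℕ
  matchings ys us = when ⌊ ys ↭? us ⌋ (listFactor us)

  matchings-↭ : ∀ ys {us us′} → us ↭ us′ → matchings ys us ≡ matchings ys us′
  matchings-↭ ys us↭us′ = cong₂ when
    (⌊⌋-⇔ (mk⇔ (λ p → ↭-trans p us↭us′) (λ p → ↭-trans p (↭-sym us↭us′))) (ys ↭? _) (ys ↭? _)) (listFactor-↭ us↭us′)

  matchings-∷ : ∀ y ys us → matchings (y ∷ ys) us ≡ occ y us * matchings ys (delete y us)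
  matchings-∷ y ys us with y ∈ℕ? us
  ... | yes y∈us = sym (trans (*-when (occ y us) ⌊ ys ↭? delete y us ⌋ _) (cong₂ when
          (⌊⌋-⇔ (mk⇔ (λ p → ↭-trans (↭-prep y p) (↭-sym (delete-↭ y∈us)))
                     (λ p → ↭.drop-∷ (↭-trans p (delete-↭ y∈us)))) (ys ↭? delete y us) (y ∷ ys ↭? us))
          (sym (listFactor-delete y∈us))))
  ... | no  y∉us = trans
          (cong (λ b → when b (listFactor us)) (⌊⌋-no (y ∷ ys ↭? us) (λ p → y∉us (↭.∈-resp-↭ p (here refl)))))
          (sym (cong (_* matchings ys (delete y us)) (occ-∉ y∉us)))

module Characters where
  open Sums
  open Multisets
  open import Data.List using (List; []; _∷_; _++_; map)
  import Data.List.Properties as LP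
  open import Data.List.Relation.Binary.Permutation.Propositional using (_↭_; ↭⇒↭ₛ′)
  import Data.List.Relation.Binary.Permutation.Propositional.Properties as ↭
  import Data.List.Relation.Binary.Permutation.Setoid.Properties as ↭ₛ
  open import Data.List.Relation.Unary.All using (All; []; _∷_)
  open import Data.Nat as ℕ using (ℕ; zero; suc; _≤_)
  open import Data.Nat.ListAction using (sum)
  open import Data.Product using (Σ; _,_; proj₁; proj₂)
  open import Function using (_∘_)
  import Relation.Binary.PropositionalEquality as ≡

  module CharacterTheory {c ℓ} (K : Field c ℓ) where
    open Field K
    open FieldOps K
    open SymFun K
    open Sum commutativeSemiring public
    open import Relation.Binary.Reasoning.Setoid setoid

    ≡⇒≈ : ∀ {x y} → x ≡.≡ y → x ≈ y
    ≡⇒≈ ≡.refl = refl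

    fromℕ-+ : ∀ m n → fromℕ (m ℕ.+ n) ≈ fromℕ m + fromℕ n
    fromℕ-+ zero    n = sym (+-identityˡ _)
    fromℕ-+ (suc m) n = trans (+-congˡ (fromℕ-+ m n)) (sym (+-assoc _ _ _))

    fromℕ-* : ∀ m n → fromℕ (m ℕ.* n) ≈ fromℕ m * fromℕ n
    fromℕ-* zero    n = sym (zeroˡ _)
    fromℕ-* (suc m) n = begin
      fromℕ (n ℕ.+ m ℕ.* n)             ≈⟨ fromℕ-+ n (m ℕ.* n) ⟩
      fromℕ n + fromℕ (m ℕ.* n)         ≈⟨ +-cong (sym (*-identityˡ _)) (fromℕ-* m n) ⟩
      1# * fromℕ n + fromℕ m * fromℕ n  ≈⟨ distribʳ _ _ _ ⟨
      (1# + fromℕ m) * fromℕ n          ∎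

    fromℕ-sum : ∀ {a} {A : Set a} (xs : List A) (f : A → ℕ) → fromℕ (sum (map f xs)) ≈ ∑[ x ← xs ] fromℕ (f x)
    fromℕ-sum []       f = refl
    fromℕ-sum (x ∷ xs) f = trans (fromℕ-+ (f x) _) (+-congˡ (fromℕ-sum xs f))

    Πᴷ-↭ : ∀ {xs ys} → xs ↭ ys → Πᴷ xs ≈ Πᴷ ys
    Πᴷ-↭ xs↭ys = ↭ₛ.foldr-commMonoid setoid *-isCommutativeMonoid (↭⇒↭ₛ′ isEquivalence xs↭ys)

    Πᴷ-++ : ∀ xs ys → Πᴷ (xs ++ ys) ≈ Πᴷ xs * Πᴷ ys
    Πᴷ-++ []       ys = sym (*-identityˡ _)
    Πᴷ-++ (x ∷ xs) ys = trans (*-congˡ (Πᴷ-++ xs ys)) (sym (*-assoc _ _ _))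

    sequenceOf : Functional → ℕ → Carrier
    sequenceOf ζ n = ev ζ (m̃ [ n ]ₚ)

    ev-m̃-factor : ∀ ζ λ' → ev ζ (m̃ λ') ≈ fromℕ (factor λ') * ζ λ'
    ev-m̃-factor ζ λ' = +-identityʳ _

    ev-m̃ : ∀ ζ λ' → ev ζ (m̃ λ') ≈ fromℕ (listFactor (parts λ')) * ζ λ'
    ev-m̃ ζ λ' = trans (ev-m̃-factor ζ λ') (*-congʳ (≡⇒≈ (≡.cong fromℕ (factor≡listFactor λ'))))

    HasProductFormula : Functional → (ℕ → Carrier) → Set ℓ
    HasProductFormula ζ a = ∀ λ' → ev ζ (m̃ λ') ≈ Πᴷ (map a (parts λ'))

    character-productFormula-toPartition : ∀ (ζ : Character) {xs} → All (1 ≤_) xs →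
      ev (proj₁ ζ) (m̃ (toPartition xs)) ≈ Πᴷ (map (sequenceOf (proj₁ ζ)) xs)
    character-productFormula-toPartition (ζ , isChar) []            = IsCharacter.unit isChar
    character-productFormula-toPartition (ζ , isChar) {x ∷ xs} (1≤x ∷ 1≤xs) = begin
      ev ζ (m̃ (toPartition (x ∷ xs)))             ≡⟨ ≡.cong (ev ζ ∘ m̃) (toPartition-∷ 1≤x 1≤xs) ⟩
      ev ζ (m̃ ([ x ]ₚ ⊔ₚ toPartition xs))         ≈⟨ IsCharacter.mult isChar [ x ]ₚ (toPartition xs) ⟩
      sequenceOf ζ x * ev ζ (m̃ (toPartition xs))  ≈⟨ *-congˡ (character-productFormula-toPartition (ζ , isChar) 1≤xs) ⟩
      sequenceOf ζ x * Πᴷ (map (sequenceOf ζ) xs) ∎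

    character-productFormula : ∀ (ζ : Character) → HasProductFormula (proj₁ ζ) (sequenceOf (proj₁ ζ))
    character-productFormula ζ λ' = begin
      ev (proj₁ ζ) (m̃ λ')                        ≡⟨ ≡.cong (ev (proj₁ ζ) ∘ m̃) (toPartition-parts λ') ⟨
      ev (proj₁ ζ) (m̃ (toPartition (parts λ')))  ≈⟨ character-productFormula-toPartition ζ (parts-pos λ') ⟩
      Πᴷ (map (sequenceOf (proj₁ ζ)) (parts λ')) ∎

    productFormula⇒isCharacter : ∀ {ζ a} → HasProductFormula ζ a → IsCharacter ζ
    productFormula⇒isCharacter {ζ} {a} formula = record
      { unit = formula ∅ₚ
      ; mult = λ λ' μ → begin
          ev ζ (m̃ (λ' ⊔ₚ μ))                           ≈⟨ formula (λ' ⊔ₚ μ) ⟩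
          Πᴷ (map a (parts (λ' ⊔ₚ μ)))                 ≈⟨ Πᴷ-↭ (↭.map⁺ a (parts-⊔ λ' μ)) ⟩
          Πᴷ (map a (parts λ' ++ parts μ))             ≈⟨ ≡⇒≈ (≡.cong Πᴷ (LP.map-++ a (parts λ') (parts μ))) ⟩
          Πᴷ (map a (parts λ') ++ map a (parts μ))     ≈⟨ Πᴷ-++ (map a (parts λ')) (map a (parts μ)) ⟩
          Πᴷ (map a (parts λ')) * Πᴷ (map a (parts μ)) ≈⟨ *-cong (formula λ') (formula μ) ⟨
          ev ζ (m̃ λ') * ev ζ (m̃ μ)                     ∎ }

    productFormula⇒sequence : ∀ {ζ a} → HasProductFormula ζ a → ∀ n → 1 ≤ n → sequenceOf ζ n ≈ a n
    productFormula⇒sequence {ζ} {a} formula n 1≤n = begin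
      ev ζ (m̃ [ n ]ₚ)            ≈⟨ formula [ n ]ₚ ⟩
      Πᴷ (map a (parts [ n ]ₚ))  ≈⟨ ≡⇒≈ (≡.cong (Πᴷ ∘ map a) parts-[ 1≤n ]ₚ) ⟩
      a n * 1#                   ≈⟨ *-identityʳ (a n) ⟩
      a n                        ∎

  module CharZeroCharacters {c ℓ} (K : Field c ℓ) (char0 : CharZero K) where
    open Field K
    open FieldOps K
    open SymFun K
    open CharacterTheory K
    open import Relation.Binary.Reasoning.Setoid setoid

    fromℕ-listFactor-invertible : ∀ xs → Σ Carrier (λ y → fromℕ (listFactor xs) * y ≈ 1#)
    fromℕ-listFactor-invertible xs with listFactor-nonZero xs
    ... | k , eq rewrite eq = inverse (fromℕ (suc k)) (char0 k)

    *-cancelˡ-invertible : ∀ {u v x y} → u * v ≈ 1# → u * x ≈ u * y → x ≈ y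
    *-cancelˡ-invertible {u} {v} {x} {y} uv≈1 ux≈uy = begin
      x             ≈⟨ *-identityˡ x ⟨
      1# * x        ≈⟨ *-congʳ (trans (*-comm v u) uv≈1) ⟨
      v * u * x     ≈⟨ *-assoc v u x ⟩
      v * (u * x)   ≈⟨ *-congˡ ux≈uy ⟩
      v * (u * y)   ≈⟨ *-assoc v u y ⟨
      v * u * y     ≈⟨ *-congʳ (trans (*-comm v u) uv≈1) ⟩
      1# * y        ≈⟨ *-identityˡ y ⟩
      y             ∎

    characters-unique : ∀ (ζ ξ : Character) →
      (∀ n → 1 ≤ n → sequenceOf (proj₁ ζ) n ≈ sequenceOf (proj₁ ξ) n) → ∀ λ' → proj₁ ζ λ' ≈ proj₁ ξ λ'
    characters-unique ζ ξ same λ' =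
      *-cancelˡ-invertible (proj₂ (fromℕ-listFactor-invertible (parts λ'))) (begin
        fromℕ (listFactor (parts λ')) * proj₁ ζ λ'       ≈⟨ ev-m̃ (proj₁ ζ) λ' ⟨
        ev (proj₁ ζ) (m̃ λ')                              ≈⟨ character-productFormula ζ λ' ⟩
        Πᴷ (map (sequenceOf (proj₁ ζ)) (parts λ'))       ≈⟨ Πᴷ-map-cong (parts-pos λ') ⟩
        Πᴷ (map (sequenceOf (proj₁ ξ)) (parts λ'))       ≈⟨ character-productFormula ξ λ' ⟨
        ev (proj₁ ξ) (m̃ λ')                              ≈⟨ ev-m̃ (proj₁ ξ) λ' ⟩
        fromℕ (listFactor (parts λ')) * proj₁ ξ λ'       ∎)
      where
      Πᴷ-map-cong : ∀ {xs} → All (1 ≤_) xs → Πᴷ (map (sequenceOf (proj₁ ζ)) xs) ≈ Πᴷ (map (sequenceOf (proj₁ ξ)) xs)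
      Πᴷ-map-cong []            = refl
      Πᴷ-map-cong (1≤x ∷ 1≤xs) = *-cong (same _ 1≤x) (Πᴷ-map-cong 1≤xs)

    characterOf : (ℕ → Carrier) → Functional
    characterOf a λ' = Πᴷ (map a (parts λ')) * proj₁ (fromℕ-listFactor-invertible (parts λ'))

    characterOf-productFormula : ∀ a → HasProductFormula (characterOf a) a
    characterOf-productFormula a λ' = begin
      ev (characterOf a) (m̃ λ')    ≈⟨ ev-m̃ (characterOf a) λ' ⟩
      f * (Π * f⁻¹)                ≈⟨ *-congˡ (*-comm Π f⁻¹) ⟩
      f * (f⁻¹ * Π)                ≈⟨ *-assoc f f⁻¹ Π ⟨
      f * f⁻¹ * Π                  ≈⟨ *-congʳ (proj₂ (fromℕ-listFactor-invertible (parts λ'))) ⟩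
      1# * Π                       ≈⟨ *-identityˡ Π ⟩
      Π                            ∎
      where
      f = fromℕ (listFactor (parts λ'))
      f⁻¹ = proj₁ (fromℕ-listFactor-invertible (parts λ'))
      Π = Πᴷ (map a (parts λ'))

    character-exists : ∀ (a : ℕ → Carrier) → Σ Character (λ ζ → ∀ n → 1 ≤ n → sequenceOf (proj₁ ζ) n ≈ a n)
    character-exists a =
      (characterOf a , productFormula⇒isCharacter (characterOf-productFormula a)) ,
      productFormula⇒sequence (characterOf-productFormula a)

module Standardisation where
  open Sums
  open Multisets
  open import Data.Bool using (Bool; true; false; T; _∧_; _∨_; not; if_then_else_)
  open import Data.Bool.ListAction using (and)
  import Data.Bool.Properties as 𝔹
  open import Data.Empty using (⊥-elim)
  open import Data.Fin as F using (Fin; toℕ)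
  import Data.Fin.Properties as FP
  open import Data.List using (List; []; _∷_; _++_; map; filter; length; foldr; concatMap; allFin; upTo; lookup; tabulate)
  open import Data.List.Membership.Propositional using (_∈_; _∉_)
  open import Data.List.Membership.Propositional.Properties using (∈-allFin; ∈-++⁺ʳ; ∈-filter⁻)
  import Data.List.Properties as LP
  open import Data.List.Relation.Unary.All as All using (All; []; _∷_)
  import Data.List.Relation.Unary.All.Properties as All
  open import Data.List.Relation.Unary.Any using (here; there)
  open import Data.List.Relation.Unary.Unique.Propositional using (Unique; []; _∷_)
  import Data.List.Relation.Unary.Unique.Propositional.Properties as Unique
  open import Data.Nat as ℕ using (ℕ; zero; suc; _+_; _*_; _∸_; _≤_; _<_; _≤?_; _<?_; _≟_; _⊔_; z≤n; s≤s)
  open import Data.Nat.ListAction using (sum)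
  import Data.Nat.Properties as ℕP
  open import Data.Product using (∃; _×_; _,_; proj₂)
  open import Data.Sum using (inj₁; inj₂)
  open import Function using (_∘_; _⇔_; mk⇔; Equivalence)
  open import Relation.Binary.PropositionalEquality
    using (_≡_; _≢_; _≗_; refl; cong; cong₂; sym; trans; subst; module ≡-Reasoning)
  open import Relation.Nullary using (Dec; yes; no)
  open import Relation.Nullary.Decidable using (⌊_⌋; toWitness)
  open Sum ℕP.+-*-commutativeSemiring

  allB-cong : ∀ {A : Set} {p q : A → Bool} xs → (∀ x → p x ≡ q x) → allB p xs ≡ allB q xs
  allB-cong xs p≗q = cong and (LP.map-cong p≗q xs)

  T-allB : ∀ {A : Set} (p : A → Bool) xs → T (allB p xs) ⇔ All (T ∘ p) xs
  T-allB p []       = mk⇔ (λ _ → []) (λ _ → _)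
  T-allB p (x ∷ xs) = mk⇔
    (λ t → let (px , pxs) = Equivalence.to 𝔹.T-∧ t in px ∷ Equivalence.to (T-allB p xs) pxs)
    (λ { (px ∷ pxs) → Equivalence.from 𝔹.T-∧ (px , Equivalence.from (T-allB p xs) pxs) })

  T-allB-allFin : ∀ {ℓ} (p : Fin ℓ → Bool) → T (allB p (allFin ℓ)) ⇔ (∀ i → T (p i))
  T-allB-allFin {ℓ} p = mk⇔
    (λ t i → All.lookup (Equivalence.to (T-allB p (allFin ℓ)) t) (∈-allFin i))
    (λ all → Equivalence.from (T-allB p (allFin ℓ)) (All.tabulate (λ {i} _ → all i)))

  map-allFin-suc : ∀ {A : Set} {ℓ} (g : Fin (suc ℓ) → A) → map g (allFin (suc ℓ)) ≡ g F.zero ∷ map (g ∘ F.suc) (allFin ℓ)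
  map-allFin-suc g = cong (g F.zero ∷_) (trans (LP.map-tabulate F.suc g) (sym (LP.map-tabulate (λ i → i) (g ∘ F.suc))))

  allB-allFin-suc : ∀ {ℓ} (p : Fin (suc ℓ) → Bool) → allB p (allFin (suc ℓ)) ≡ p F.zero ∧ allB (p ∘ F.suc) (allFin ℓ)
  allB-allFin-suc p = cong and (map-allFin-suc p)

  ≟-toℕ : ∀ {ℓ} (i j : Fin ℓ) → ⌊ toℕ i ≟ toℕ j ⌋ ≡ ⌊ i F.≟ j ⌋
  ≟-toℕ i j = ⌊⌋-⇔ (mk⇔ FP.toℕ-injective (cong toℕ)) (toℕ i ≟ toℕ j) (i F.≟ j)

  -- Colourings with values in ℕ, so that colourings with different palettes can be compared.
  module ColouringsOf (G : WGraph) where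

    isProperℕ : (Fin (n G) → ℕ) → Bool
    isProperℕ h = allB (λ u → allB (λ v → not (adj G u v) ∨ not ⌊ h u ≟ h v ⌋) (allFin (n G))) (allFin (n G))

    classWeightℕ : (Fin (n G) → ℕ) → ℕ → ℕ
    classWeightℕ h j = ∑[ v ← allFin (n G) ] when ⌊ h v ≟ j ⌋ (w G v)

    isProperℕ-cong : ∀ {h h′} → h ≗ h′ → isProperℕ h ≡ isProperℕ h′
    isProperℕ-cong h≗h′ = allB-cong (allFin (n G)) λ u → allB-cong (allFin (n G)) λ v →
      cong₂ (λ a b → not (adj G u v) ∨ not ⌊ a ≟ b ⌋) (h≗h′ u) (h≗h′ v)

    classWeightℕ-cong : ∀ {h h′} → h ≗ h′ → ∀ j → classWeightℕ h j ≡ classWeightℕ h′ j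
    classWeightℕ-cong h≗h′ j = ∑-cong (allFin (n G)) λ v → cong (λ a → when ⌊ a ≟ j ⌋ (w G v)) (h≗h′ v)

    isProper-toℕ : ∀ {k} (κ : Fin (n G) → Fin k) → isProper G κ ≡ isProperℕ (toℕ ∘ κ)
    isProper-toℕ κ = allB-cong (allFin (n G)) λ u → allB-cong (allFin (n G)) λ v →
      cong (λ b → not (adj G u v) ∨ not b) (sym (≟-toℕ (κ u) (κ v)))

    classWeight-toℕ : ∀ {k} (κ : Fin (n G) → Fin k) i → classWeight G κ i ≡ classWeightℕ (toℕ ∘ κ) (toℕ i)
    classWeight-toℕ κ i = trans (∑-filter (λ v → κ v F.≟ i) (allFin (n G)) (w G))
      (∑-cong (allFin (n G)) λ v → cong (λ b → when b (w G v)) (sym (≟-toℕ (κ v) i)))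

  -- f continues a restricted growth function whose earlier vertices used the labels 0, …, m - 1
  isRGFFrom : ∀ {n K} → ℕ → (Fin n → Fin K) → Bool
  isRGFFrom {zero}  m f = true
  isRGFFrom {suc n} m f = ⌊ toℕ (f F.zero) ≤? m ⌋ ∧ isRGFFrom (m ⊔ suc (toℕ (f F.zero))) (f ∘ F.suc)

  blocksFrom : ∀ {n K} → ℕ → (Fin n → Fin K) → ℕ
  blocksFrom {zero}  m f = m
  blocksFrom {suc n} m f = blocksFrom (m ⊔ suc (toℕ (f F.zero))) (f ∘ F.suc)

  labelsBefore′ : ∀ {n K} → (Fin n → Fin K) → Fin n → ℕ
  labelsBefore′ f v = foldr _⊔_ 0 (map (λ u → if ⌊ toℕ u <? toℕ v ⌋ then suc (toℕ (f u)) else 0) (allFin _))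

  labelsBefore′-zero : ∀ {n K} (f : Fin (suc n) → Fin K) → labelsBefore′ f F.zero ≡ 0
  labelsBefore′-zero {n} f = foldr-⊔-zeros (allFin (suc n))
    where
    foldr-⊔-zeros : ∀ {A : Set} (xs : List A) → foldr _⊔_ 0 (map (λ _ → 0) xs) ≡ 0
    foldr-⊔-zeros []       = refl
    foldr-⊔-zeros (x ∷ xs) = foldr-⊔-zeros xs

  labelsBefore′-suc : ∀ {n K} (f : Fin (suc n) → Fin K) v →
                      labelsBefore′ f (F.suc v) ≡ suc (toℕ (f F.zero)) ⊔ labelsBefore′ (f ∘ F.suc) v
  labelsBefore′-suc {n} f v = cong (foldr _⊔_ 0) (trans (map-allFin-suc _) (cong (suc (toℕ (f F.zero)) ∷_)
    (LP.map-cong (λ u → cong (λ b → if b then suc (toℕ (f (F.suc u))) else 0) (<?-suc (toℕ u) (toℕ v))) (allFin n))))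
    where
    <?-suc : ∀ a b → ⌊ suc a <? suc b ⌋ ≡ ⌊ a <? b ⌋
    <?-suc a b = ⌊⌋-⇔ (mk⇔ ℕP.≤-pred s≤s) (suc a <? suc b) (a <? b)

  isRGF-from : ∀ {n K} m (f : Fin n → Fin K) → allB (λ v → ⌊ toℕ (f v) ≤? m ⊔ labelsBefore′ f v ⌋) (allFin n) ≡ isRGFFrom m f
  isRGF-from {zero}  m f = refl
  isRGF-from {suc n} m f = trans (allB-allFin-suc (λ v → ⌊ toℕ (f v) ≤? m ⊔ labelsBefore′ f v ⌋)) (cong₂ _∧_
    (cong (λ k → ⌊ toℕ (f F.zero) ≤? k ⌋) (trans (cong (m ⊔_) (labelsBefore′-zero f)) (ℕP.⊔-identityʳ m)))
    (trans (allB-cong (allFin n) λ v → cong (λ k → ⌊ toℕ (f (F.suc v)) ≤? k ⌋)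
              (trans (cong (m ⊔_) (labelsBefore′-suc f v)) (sym (ℕP.⊔-assoc m _ _))))
           (isRGF-from (m ⊔ suc (toℕ (f F.zero))) (f ∘ F.suc))))

  isRGF≡isRGFFrom0 : ∀ {n} (f : Fin n → Fin n) → isRGF f ≡ isRGFFrom 0 f
  isRGF≡isRGFFrom0 = isRGF-from 0

  blocksFrom-max : ∀ {n K} m (f : Fin n → Fin K) → blocksFrom m f ≡ m ⊔ foldr _⊔_ 0 (map (suc ∘ toℕ ∘ f) (allFin n))
  blocksFrom-max {zero}  m f = sym (ℕP.⊔-identityʳ m)
  blocksFrom-max {suc n} m f = trans (blocksFrom-max (m ⊔ suc (toℕ (f F.zero))) (f ∘ F.suc))
    (trans (ℕP.⊔-assoc m _ _) (cong (λ l → m ⊔ foldr _⊔_ 0 l) (sym (map-allFin-suc (suc ∘ toℕ ∘ f)))))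

  numBlocks≡blocksFrom0 : ∀ {n} (f : Fin n → Fin n) → numBlocks f ≡ blocksFrom 0 f
  numBlocks≡blocksFrom0 f = sym (blocksFrom-max 0 f)

  blocksFrom-≥ : ∀ {n K} m (f : Fin n → Fin K) → m ≤ blocksFrom m f
  blocksFrom-≥ {zero}  m f = ℕP.≤-refl
  blocksFrom-≥ {suc n} m f = ℕP.≤-trans (ℕP.m≤m⊔n m _) (blocksFrom-≥ _ (f ∘ F.suc))

  label<blocksFrom : ∀ {n K} m (f : Fin n → Fin K) v → toℕ (f v) < blocksFrom m f
  label<blocksFrom {suc n} m f F.zero    = ℕP.≤-trans (ℕP.m≤n⊔m m _) (blocksFrom-≥ _ (f ∘ F.suc))
  label<blocksFrom {suc n} m f (F.suc v) = label<blocksFrom (m ⊔ suc (toℕ (f F.zero))) (f ∘ F.suc) v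

  isRGFFrom-surjective : ∀ {n K} m (f : Fin n → Fin K) → T (isRGFFrom m f) →
                         ∀ {b} → m ≤ b → b < blocksFrom m f → ∃ λ v → toℕ (f v) ≡ b
  isRGFFrom-surjective {zero}  m f _   m≤b b<m = ⊥-elim (ℕP.<⇒≱ b<m m≤b)
  isRGFFrom-surjective {suc n} m f rgf {b} m≤b b< with b ≟ toℕ (f F.zero)
  ... | yes b≡f₀ = F.zero , sym b≡f₀
  ... | no  b≢f₀ =
    let f₀≤m , rgf′ = Equivalence.to 𝔹.T-∧ rgf
        f₀<b        = ℕP.≤∧≢⇒< (ℕP.≤-trans (toWitness f₀≤m) m≤b) (b≢f₀ ∘ sym)
        v , fv≡b    = isRGFFrom-surjective _ (f ∘ F.suc) rgf′ (ℕP.⊔-lub m≤b f₀<b) b<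
    in F.suc v , fv≡b

  module _ {ℓ : ℕ} where
    open import Data.List.Membership.DecPropositional (F._≟_ {ℓ}) public using (_∈?_; _∉?_)

  -- the lists of j distinct colours outside ps
  arrangements : ∀ {ℓ} → List (Fin ℓ) → ℕ → List (List (Fin ℓ))
  arrangements     ps zero    = [] ∷ []
  arrangements {ℓ} ps (suc j) = concatMap (λ q → map (q ∷_) (arrangements (ps ++ q ∷ []) j)) (filter (_∉? ps) (allFin ℓ))

  ∑-arrangements-suc : ∀ {ℓ} (ps : List (Fin ℓ)) j (g : List (Fin ℓ) → ℕ) →
    ∑ (arrangements ps (suc j)) g ≡ ∑[ q ← allFin ℓ ] when ⌊ q ∉? ps ⌋ (∑[ qs ← arrangements (ps ++ q ∷ []) j ] g (q ∷ qs))
  ∑-arrangements-suc {ℓ} ps j g = begin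
    ∑ (arrangements ps (suc j)) g
      ≡⟨ ∑-concatMap (filter (_∉? ps) (allFin ℓ)) _ g ⟩
    ∑[ q ← filter (_∉? ps) (allFin ℓ) ] ∑ (map (q ∷_) (arrangements (ps ++ q ∷ []) j)) g
      ≡⟨ ∑-cong (filter (_∉? ps) (allFin ℓ)) (λ q → ∑-map (arrangements (ps ++ q ∷ []) j) (q ∷_) g) ⟩
    ∑[ q ← filter (_∉? ps) (allFin ℓ) ] ∑[ qs ← arrangements (ps ++ q ∷ []) j ] g (q ∷ qs)
      ≡⟨ ∑-filter (_∉? ps) (allFin ℓ) _ ⟩
    ∑[ q ← allFin ℓ ] when ⌊ q ∉? ps ⌋ (∑[ qs ← arrangements (ps ++ q ∷ []) j ] g (q ∷ qs)) ∎
    where open ≡-Reasoning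

  Unique-snoc : ∀ {A : Set} {ps : List A} {q} → Unique ps → q ∉ ps → Unique (ps ++ q ∷ [])
  Unique-snoc !ps q∉ps = Unique.++⁺ !ps ([] ∷ []) λ { (q∈ps , here refl) → q∉ps q∈ps }

  Unique-++⁻ : ∀ {A : Set} (ps : List A) {qs} → Unique (ps ++ qs) → ∀ {x} → x ∈ ps → x ∉ qs
  Unique-++⁻ (p ∷ ps) (p∉ ∷ !ps) (here refl) x∈qs = All.lookup p∉ (∈-++⁺ʳ ps x∈qs) refl
  Unique-++⁻ (p ∷ ps) (p∉ ∷ !ps) (there x∈)  x∈qs = Unique-++⁻ ps !ps x∈ x∈qs

  arrangements-unique : ∀ {ℓ} (ps : List (Fin ℓ)) j → Unique ps →
                        All (λ qs → Unique (ps ++ qs) × length qs ≡ j) (arrangements ps j)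
  arrangements-unique ps zero    !ps = (subst Unique (sym (LP.++-identityʳ ps)) !ps , refl) ∷ []
  arrangements-unique {ℓ} ps (suc j) !ps =
    All.concat⁺ (All.map⁺ (All.tabulate {xs = filter (_∉? ps) (allFin ℓ)} extend))
    where
    extend : ∀ {q} → q ∈ filter (_∉? ps) (allFin ℓ) →
             All (λ qs → Unique (ps ++ qs) × length qs ≡ suc j) (map (q ∷_) (arrangements (ps ++ q ∷ []) j))
    extend {q} q∈ = All.map⁺ (All.map
      (λ { (!ps+q+qs , len) → subst Unique (LP.++-assoc ps (q ∷ []) _) !ps+q+qs , cong suc len })
      (arrangements-unique (ps ++ q ∷ []) j (Unique-snoc !ps (proj₂ (∈-filter⁻ (_∉? ps) {xs = allFin ℓ} q∈)))))

  -- positions past the end of qs give the junk value 0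
  colourAt : ∀ {ℓ} → List (Fin ℓ) → ℕ → ℕ
  colourAt []       _       = 0
  colourAt (q ∷ qs) zero    = toℕ q
  colourAt (q ∷ qs) (suc b) = colourAt qs b

  colourAt-++ˡ : ∀ {ℓ} (ps qs : List (Fin ℓ)) (j : Fin (length ps)) → colourAt (ps ++ qs) (toℕ j) ≡ toℕ (lookup ps j)
  colourAt-++ˡ (p ∷ ps) qs F.zero    = refl
  colourAt-++ˡ (p ∷ ps) qs (F.suc j) = colourAt-++ˡ ps qs j

  colourAt-length : ∀ {ℓ} (ps : List (Fin ℓ)) q qs → colourAt (ps ++ q ∷ qs) (length ps) ≡ toℕ q
  colourAt-length []       q qs = refl
  colourAt-length (p ∷ ps) q qs = colourAt-length ps q qs

  colourAt-∈ : ∀ {ℓ} (qs : List (Fin ℓ)) {b} → b < length qs → ∃ λ x → x ∈ qs × colourAt qs b ≡ toℕ x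
  colourAt-∈ (q ∷ qs) {zero}  _         = q , here refl , refl
  colourAt-∈ (q ∷ qs) {suc b} (s≤s b<) = let x , x∈ , eq = colourAt-∈ qs b< in x , there x∈ , eq

  colourAt-injective : ∀ {ℓ} {qs : List (Fin ℓ)} → Unique qs →
                       ∀ {a b} → a < length qs → b < length qs → colourAt qs a ≡ colourAt qs b → a ≡ b
  colourAt-injective {qs = q ∷ qs} _ {zero}  {zero}  _ _ _ = refl
  colourAt-injective {qs = q ∷ qs} (q∉ ∷ _) {zero} {suc b} _ (s≤s b<) eq =
    let x , x∈ , eq′ = colourAt-∈ qs b< in ⊥-elim (All.lookup q∉ x∈ (FP.toℕ-injective (trans eq eq′)))
  colourAt-injective {qs = q ∷ qs} (q∉ ∷ _) {suc a} {zero} (s≤s a<) _ eq =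
    let x , x∈ , eq′ = colourAt-∈ qs a< in ⊥-elim (All.lookup q∉ x∈ (FP.toℕ-injective (trans (sym eq) eq′)))
  colourAt-injective {qs = q ∷ qs} (_ ∷ !qs) {suc a} {suc b} (s≤s a<) (s≤s b<) eq =
    cong suc (colourAt-injective !qs a< b< eq)

  map-toℕ-allFin : ∀ K → map toℕ (allFin K) ≡ upTo K
  map-toℕ-allFin zero    = refl
  map-toℕ-allFin (suc K) = cong (0 ∷_) (begin
    map toℕ (tabulate F.suc)        ≡⟨ LP.map-tabulate F.suc toℕ ⟩
    tabulate (suc ∘ toℕ)            ≡⟨ LP.map-tabulate (λ i → i) (suc ∘ toℕ) ⟨
    map (suc ∘ toℕ) (allFin K)      ≡⟨ LP.map-∘ (allFin K) ⟩
    map suc (map toℕ (allFin K))    ≡⟨ cong (map suc) (map-toℕ-allFin K) ⟩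
    map suc (upTo K)                ≡⟨ LP.map-upTo suc K ⟩
    Data.List.applyUpTo suc K       ∎)
    where open ≡-Reasoning

  ∑-allFin-toℕ : ∀ K (g : ℕ → ℕ) → ∑[ c ← allFin K ] g (toℕ c) ≡ ∑ (upTo K) g
  ∑-allFin-toℕ K g = trans (sym (∑-map (allFin K) toℕ g)) (cong (λ is → ∑ is g) (map-toℕ-allFin K))

  ∑-allFin-lookup : ∀ {A : Set} (ps : List A) (g : A → ℕ) → ∑[ j ← allFin (length ps) ] g (lookup ps j) ≡ ∑ ps g
  ∑-allFin-lookup ps g = trans (sym (∑-map (allFin (length ps)) (lookup ps) g))
    (cong (λ xs → ∑ xs g) (trans (LP.map-tabulate (λ i → i) (lookup ps)) (LP.tabulate-lookup ps)))

  ∑-upTo-suc : ∀ N (g : ℕ → ℕ) → ∑ (upTo (suc N)) g ≡ ∑ (upTo N) g + g N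
  ∑-upTo-suc N g = begin
    ∑ (upTo (suc N)) g          ≡⟨ cong (λ is → ∑ is g) (LP.upTo-∷ʳ N) ⟨
    ∑ (upTo N ++ N ∷ []) g      ≡⟨ ∑-++ (upTo N) (N ∷ []) g ⟩
    ∑ (upTo N) g + (g N + 0)    ≡⟨ cong (∑ (upTo N) g +_) (ℕP.+-identityʳ (g N)) ⟩
    ∑ (upTo N) g + g N          ∎
    where open ≡-Reasoning

  ∑-upTo-vanishing : ∀ {N K} (g : ℕ → ℕ) → (∀ i → N ≤ i → g i ≡ 0) → N ≤ K → ∑ (upTo K) g ≡ ∑ (upTo N) g
  ∑-upTo-vanishing {N} {zero}  g vanish z≤n = refl
  ∑-upTo-vanishing {N} {suc K} g vanish N≤1+K with ℕP.m≤n⇒m<n∨m≡n N≤1+K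
  ... | inj₂ refl      = refl
  ... | inj₁ (s≤s N≤K) = begin
    ∑ (upTo (suc K)) g      ≡⟨ ∑-upTo-suc K g ⟩
    ∑ (upTo K) g + g K      ≡⟨ cong₂ _+_ (∑-upTo-vanishing g vanish N≤K) (vanish K N≤K) ⟩
    ∑ (upTo N) g + 0        ≡⟨ ℕP.+-identityʳ _ ⟩
    ∑ (upTo N) g            ∎
    where open ≡-Reasoning

  ∑-split : ∀ {A : Set} {P : A → Set} (P? : ∀ x → Dec (P x)) xs (g : A → ℕ) →
            ∑ xs g ≡ ∑[ x ← xs ] when ⌊ P? x ⌋ (g x) + ∑[ x ← xs ] when (not ⌊ P? x ⌋) (g x)
  ∑-split P? xs g = trans (∑-cong xs λ x → split (⌊ P? x ⌋) (g x)) (∑-distrib-+ xs _ _)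
    where
    split : ∀ b k → k ≡ when b k + when (not b) k
    split true  k = sym (ℕP.+-identityʳ k)
    split false k = refl

  infixr 5 _▸_
  _▸_ : ∀ {n} → ℕ → (Fin n → ℕ) → Fin (suc n) → ℕ
  (x ▸ h) F.zero    = x
  (x ▸ h) (F.suc v) = h v

  ▸-η : ∀ {n} (h : Fin (suc n) → ℕ) → h ≗ (h F.zero ▸ h ∘ F.suc)
  ▸-η h F.zero    = refl
  ▸-η h (F.suc v) = refl

  ▸-congˡ : ∀ {n x y} → x ≡ y → (h : Fin n → ℕ) → (x ▸ h) ≗ (y ▸ h)
  ▸-congˡ x≡y h F.zero    = x≡y
  ▸-congˡ x≡y h (F.suc v) = refl

  ▸-congʳ : ∀ {n} x {h h′ : Fin n → ℕ} → h ≗ h′ → (x ▸ h) ≗ (x ▸ h′)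
  ▸-congʳ x h≗h′ F.zero    = refl
  ▸-congʳ x h≗h′ (F.suc v) = h≗h′ v

  Extensional : ∀ {n} → ((Fin n → ℕ) → ℕ) → Set
  Extensional H = ∀ {h h′} → h ≗ h′ → H h ≡ H h′

  ∑-allFuns-suc : ∀ n ℓ (g : (Fin (suc n) → Fin ℓ) → ℕ) (g′ : Fin ℓ → (Fin n → Fin ℓ) → ℕ) →
                  (∀ h → g h ≡ g′ (h F.zero) (h ∘ F.suc)) →
                  ∑ (allFuns (suc n) ℓ) g ≡ ∑[ c ← allFin ℓ ] ∑ (allFuns n ℓ) (g′ c)
  ∑-allFuns-suc n ℓ g g′ g≡g′ = trans (∑-concatMap (allFin ℓ) _ g) (∑-cong (allFin ℓ) λ c →
    trans (∑-map (allFuns n ℓ) _ g) (∑-cong (allFuns n ℓ) λ f → g≡g′ _))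

  -- The sum of H over the colourings c ∘ f, where f is a restricted growth function continuing
  -- a prefix with m blocks and c assigns the colours ps to those blocks and new colours qs to the others.
  standardSum : ∀ {n ℓ} K (ps : List (Fin ℓ)) m (H : (Fin n → ℕ) → ℕ) → ℕ
  standardSum {n} K ps m H = ∑[ f ← allFuns n K ] when (isRGFFrom m f)
    (∑[ qs ← arrangements ps (blocksFrom m f ∸ m) ] H (colourAt (ps ++ qs) ∘ toℕ ∘ f))

  -- the terms of standardSum in which the first vertex gets the label i
  firstLabelSum : ∀ {n ℓ} K (ps : List (Fin ℓ)) m (H : (Fin (suc n) → ℕ) → ℕ) → ℕ → ℕ
  firstLabelSum {n} K ps m H i = ∑[ f ← allFuns n K ] when (⌊ i ≤? m ⌋ ∧ isRGFFrom (m ⊔ suc i) f)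
    (∑[ qs ← arrangements ps (blocksFrom (m ⊔ suc i) f ∸ m) ] H (colourAt (ps ++ qs) i ▸ colourAt (ps ++ qs) ∘ toℕ ∘ f))

  standardSum-suc : ∀ {n ℓ} K (ps : List (Fin ℓ)) m (H : (Fin (suc n) → ℕ) → ℕ) → Extensional H →
                    standardSum K ps m H ≡ ∑[ c ← allFin K ] firstLabelSum K ps m H (toℕ c)
  standardSum-suc {n} K ps m H ext = ∑-allFuns-suc n K _ _ λ f →
    cong (when (isRGFFrom m f)) (∑-cong (arrangements ps (blocksFrom m f ∸ m)) λ qs → ext (▸-η _))

  firstLabelSum-old : ∀ {n ℓ} K (ps : List (Fin ℓ)) (H : (Fin (suc n) → ℕ) → ℕ) → Extensional H →
    ∀ (j : Fin (length ps)) →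
    firstLabelSum K ps (length ps) H (toℕ j) ≡ standardSum K ps (length ps) (λ h → H (toℕ (lookup ps j) ▸ h))
  firstLabelSum-old {n} K ps H ext j with toℕ j ≤? length ps
  ... | no  j≰m = ⊥-elim (j≰m (ℕP.<⇒≤ (FP.toℕ<n j)))
  ... | yes _ rewrite ℕP.m≥n⇒m⊔n≡m (FP.toℕ<n j) =
    ∑-cong (allFuns n K) λ f → cong (when (isRGFFrom (length ps) f)) (∑-cong (arrangements ps (blocksFrom (length ps) f ∸ length ps)) λ qs →
      ext (▸-congˡ (colourAt-++ˡ ps qs j) (colourAt (ps ++ qs) ∘ toℕ ∘ f)))

  firstLabelSum-vanishing : ∀ {n ℓ} K (ps : List (Fin ℓ)) m (H : (Fin (suc n) → ℕ) → ℕ) →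
                            ∀ i → m < i → firstLabelSum K ps m H i ≡ 0
  firstLabelSum-vanishing {n} K ps m H i m<i with i ≤? m
  ... | yes i≤m = ⊥-elim (ℕP.<⇒≱ m<i i≤m)
  ... | no  _   = ∑-zero (allFuns n K)

  ∸≡suc∸suc : ∀ {a m} → m < a → a ∸ m ≡ suc (a ∸ suc m)
  ∸≡suc∸suc {suc a} {zero}  _         = refl
  ∸≡suc∸suc {suc a} {suc m} (s≤s m<a) = ∸≡suc∸suc m<a

  firstLabelSum-new : ∀ {n ℓ} K (ps : List (Fin ℓ)) (H : (Fin (suc n) → ℕ) → ℕ) → Extensional H →
    firstLabelSum K ps (length ps) H (length ps) ≡
    ∑[ q ← allFin ℓ ] when ⌊ q ∉? ps ⌋ (standardSum K (ps ++ q ∷ []) (suc (length ps)) (λ h → H (toℕ q ▸ h)))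
  firstLabelSum-new {n} {ℓ} K ps H ext with length ps ≤? length ps
  ... | no  m≰m = ⊥-elim (m≰m ℕP.≤-refl)
  ... | yes _ rewrite ℕP.m≤n⇒m⊔n≡n (ℕP.n≤1+n (length ps)) = begin
    ∑[ f ← allFuns n K ] when (isRGFFrom (suc m) f) (∑ (arrangements ps (blocksFrom (suc m) f ∸ m)) (G f))
      ≡⟨ ∑-cong (allFuns n K) (λ f → cong (when (isRGFFrom (suc m) f)) (newColour f)) ⟩
    ∑[ f ← allFuns n K ] when (isRGFFrom (suc m) f) (∑[ q ← allFin ℓ ] when ⌊ q ∉? ps ⌋ (B q f))
      ≡⟨ ∑-cong (allFuns n K) (λ f → when-∑ (isRGFFrom (suc m) f) (allFin ℓ) _) ⟩
    ∑[ f ← allFuns n K ] ∑[ q ← allFin ℓ ] when (isRGFFrom (suc m) f) (when ⌊ q ∉? ps ⌋ (B q f))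
      ≡⟨ ∑-comm (allFuns n K) (allFin ℓ) _ ⟩
    ∑[ q ← allFin ℓ ] ∑[ f ← allFuns n K ] when (isRGFFrom (suc m) f) (when ⌊ q ∉? ps ⌋ (B q f))
      ≡⟨ ∑-cong (allFin ℓ) (λ q → trans (∑-cong (allFuns n K) λ f → when-comm (isRGFFrom (suc m) f) ⌊ q ∉? ps ⌋ (B q f))
                                         (sym (when-∑ ⌊ q ∉? ps ⌋ (allFuns n K) λ f → when (isRGFFrom (suc m) f) (B q f)))) ⟩
    ∑[ q ← allFin ℓ ] when ⌊ q ∉? ps ⌋ (∑[ f ← allFuns n K ] when (isRGFFrom (suc m) f) (B q f)) ∎
    where
    open ≡-Reasoning
    m = length ps
    G : (Fin n → Fin K) → List (Fin ℓ) → ℕ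
    G f qs = H (colourAt (ps ++ qs) m ▸ colourAt (ps ++ qs) ∘ toℕ ∘ f)
    B : Fin ℓ → (Fin n → Fin K) → ℕ
    B q f = ∑[ qs ← arrangements (ps ++ q ∷ []) (blocksFrom (suc m) f ∸ suc m) ]
              H (toℕ q ▸ colourAt ((ps ++ q ∷ []) ++ qs) ∘ toℕ ∘ f)
    newColour : ∀ f → ∑ (arrangements ps (blocksFrom (suc m) f ∸ m)) (G f) ≡ ∑[ q ← allFin ℓ ] when ⌊ q ∉? ps ⌋ (B q f)
    newColour f = begin
      ∑ (arrangements ps (blocksFrom (suc m) f ∸ m)) (G f)
        ≡⟨ cong (λ j → ∑ (arrangements ps j) (G f)) (∸≡suc∸suc (blocksFrom-≥ (suc m) f)) ⟩
      ∑ (arrangements ps (suc (blocksFrom (suc m) f ∸ suc m))) (G f)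
        ≡⟨ ∑-arrangements-suc ps j (G f) ⟩
      ∑[ q ← allFin ℓ ] when ⌊ q ∉? ps ⌋ (∑[ qs ← arrangements (ps ++ q ∷ []) j ] G f (q ∷ qs))
        ≡⟨ ∑-cong (allFin ℓ) (λ q → cong (when ⌊ q ∉? ps ⌋) (∑-cong (arrangements (ps ++ q ∷ []) j) λ qs →
             ext (relabel q qs))) ⟩
      ∑[ q ← allFin ℓ ] when ⌊ q ∉? ps ⌋ (B q f) ∎
      where
      j = blocksFrom (suc m) f ∸ suc m
      relabel : ∀ q qs → (colourAt (ps ++ q ∷ qs) m ▸ colourAt (ps ++ q ∷ qs) ∘ toℕ ∘ f)
                       ≗ (toℕ q ▸ colourAt ((ps ++ q ∷ []) ++ qs) ∘ toℕ ∘ f)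
      relabel q qs F.zero    = colourAt-length ps q qs
      relabel q qs (F.suc v) = cong (λ xs → colourAt xs (toℕ (f v))) (sym (LP.++-assoc ps (q ∷ []) qs))

  -- Every colouring factors uniquely as a restricted growth function followed by an injective colouring of its blocks.
  ∑-standardise : ∀ n {ℓ} K (ps : List (Fin ℓ)) m → length ps ≡ m → Unique ps → m + n ≤ K →
                  (H : (Fin n → ℕ) → ℕ) → Extensional H →
                  ∑[ κ ← allFuns n ℓ ] H (toℕ ∘ κ) ≡ standardSum K ps m H
  ∑-standardise zero {ℓ} K ps m _ _ _ H ext = cong (_+ 0) (noVertices _ _)
    where
    open ≡-Reasoning
    noVertices : ∀ (κ : Fin 0 → Fin ℓ) (f : Fin 0 → Fin K) →
                 H (toℕ ∘ κ) ≡ ∑[ qs ← arrangements ps (m ∸ m) ] H (colourAt (ps ++ qs) ∘ toℕ ∘ f)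
    noVertices κ f = begin
      H (toℕ ∘ κ)                                                    ≡⟨ ext (λ ()) ⟩
      H (colourAt (ps ++ []) ∘ toℕ ∘ f)                              ≡⟨ ℕP.+-identityʳ _ ⟨
      ∑[ qs ← arrangements ps 0 ] H (colourAt (ps ++ qs) ∘ toℕ ∘ f)
        ≡⟨ cong (λ j → ∑[ qs ← arrangements ps j ] H (colourAt (ps ++ qs) ∘ toℕ ∘ f)) (ℕP.n∸n≡0 m) ⟨
      ∑[ qs ← arrangements ps (m ∸ m) ] H (colourAt (ps ++ qs) ∘ toℕ ∘ f) ∎
  ∑-standardise (suc n) {ℓ} K ps .(length ps) refl !ps m+1+n≤K H ext = begin
    ∑[ κ ← allFuns (suc n) ℓ ] H (toℕ ∘ κ)
      ≡⟨ ∑-allFuns-suc n ℓ _ (λ c κ → H (toℕ c ▸ toℕ ∘ κ)) (λ κ → ext (▸-η (toℕ ∘ κ))) ⟩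
    ∑[ c ← allFin ℓ ] Φ c
      ≡⟨ ∑-split (_∈? ps) (allFin ℓ) Φ ⟩
    ∑[ c ← allFin ℓ ] when ⌊ c ∈? ps ⌋ (Φ c) + ∑[ c ← allFin ℓ ] when (not ⌊ c ∈? ps ⌋) (Φ c)
      ≡⟨ cong₂ _+_ oldColours newColour ⟩
    ∑ (upTo m) Ψ + Ψ m
      ≡⟨ ∑-upTo-suc m Ψ ⟨
    ∑ (upTo (suc m)) Ψ
      ≡⟨ ∑-upTo-vanishing Ψ (firstLabelSum-vanishing K ps m H) 1+m≤K ⟨
    ∑ (upTo K) Ψ
      ≡⟨ ∑-allFin-toℕ K Ψ ⟨
    ∑[ c ← allFin K ] Ψ (toℕ c)
      ≡⟨ standardSum-suc K ps m H ext ⟨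
    standardSum K ps m H ∎
    where
    open ≡-Reasoning
    m = length ps
    Φ : Fin ℓ → ℕ
    Φ c = ∑[ κ ← allFuns n ℓ ] H (toℕ c ▸ toℕ ∘ κ)
    Ψ : ℕ → ℕ
    Ψ = firstLabelSum K ps m H
    1+m≤K : suc m ≤ K
    1+m≤K = ℕP.≤-trans (s≤s (ℕP.m≤m+n m n)) (ℕP.≤-trans (ℕP.≤-reflexive (sym (ℕP.+-suc m n))) m+1+n≤K)
    m+n≤K : m + n ≤ K
    m+n≤K = ℕP.≤-trans (ℕP.+-monoʳ-≤ m (ℕP.n≤1+n n)) m+1+n≤K
    oldColours : ∑[ c ← allFin ℓ ] when ⌊ c ∈? ps ⌋ (Φ c) ≡ ∑ (upTo m) Ψ
    oldColours = begin
      ∑[ c ← allFin ℓ ] when ⌊ c ∈? ps ⌋ (Φ c)       ≡⟨ ∑-∈? F._≟_ Φ (Unique.allFin⁺ ℓ) !ps (λ {c} _ → ∈-allFin c) ⟩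
      ∑ ps Φ                                         ≡⟨ ∑-allFin-lookup ps Φ ⟨
      ∑[ j ← allFin m ] Φ (lookup ps j)              ≡⟨ ∑-cong (allFin m) (λ j → trans
                                                          (∑-standardise n K ps m refl !ps m+n≤K _ (ext ∘ ▸-congʳ (toℕ (lookup ps j))))
                                                          (sym (firstLabelSum-old K ps H ext j))) ⟩
      ∑[ j ← allFin m ] Ψ (toℕ j)                    ≡⟨ ∑-allFin-toℕ m Ψ ⟩
      ∑ (upTo m) Ψ                                   ∎
    newColour : ∑[ c ← allFin ℓ ] when (not ⌊ c ∈? ps ⌋) (Φ c) ≡ Ψ m
    newColour = trans (∑-cong (allFin ℓ) extend) (sym (firstLabelSum-new K ps H ext))
      where
      extend : ∀ c → when (not ⌊ c ∈? ps ⌋) (Φ c) ≡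
                     when ⌊ c ∉? ps ⌋ (standardSum K (ps ++ c ∷ []) (suc m) (λ h → H (toℕ c ▸ h)))
      extend c with c ∈? ps
      ... | yes _   = refl
      ... | no  c∉ps = ∑-standardise n K (ps ++ c ∷ []) (suc m) (trans (LP.length-++ ps) (ℕP.+-comm m 1))
                         (Unique-snoc !ps c∉ps) (ℕP.≤-trans (ℕP.≤-reflexive (sym (ℕP.+-suc m n))) m+1+n≤K)
                         _ (ext ∘ ▸-congʳ (toℕ c))

module ArrangementCounts where
  open Sums
  open Multisets
  open Standardisation
  open import Data.Bool using (Bool; T; _∧_; _∨_)
  import Data.Bool.Properties as 𝔹
  open import Data.Empty using (⊥-elim)
  open import Data.Fin as F using (Fin; toℕ)
  import Data.Fin.Properties as FP
  open import Data.List using (List; []; _∷_; _++_; map; filter; length; allFin)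
  open import Data.List.Membership.Propositional using (_∈_; _∉_)
  open import Data.List.Membership.Propositional.Properties using (∈-allFin; ∈-++⁺ˡ; ∈-++⁺ʳ; ∈-++⁻; ∈-filter⁺)
  import Data.List.Properties as LP
  open import Data.List.Relation.Binary.Permutation.Propositional using (_↭_; ↭-refl; ↭-sym; ↭-trans; ↭-prep; ↭-swap; ↭-reflexive)
  import Data.List.Relation.Binary.Permutation.Propositional.Properties as ↭
  open import Data.List.Relation.Unary.All as All using (All; []; _∷_)
  import Data.List.Relation.Unary.All.Properties as All
  open import Data.List.Relation.Unary.Any using (here; there)
  open import Data.List.Relation.Unary.Unique.Propositional using (Unique; []; _∷_)
  import Data.List.Relation.Unary.Unique.Propositional.Properties as Unique
  open import Data.Nat as ℕ using (ℕ; suc; _+_; _*_; _≤_; _<_; _≟_)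
  import Data.Nat.Properties as ℕP
  open import Data.Product using (_,_)
  open import Data.Sum using (_⊎_; inj₁; inj₂)
  open import Function using (_∘_; _⇔_; mk⇔; Equivalence; case_of_)
  open import Relation.Binary.PropositionalEquality
    using (_≡_; _≢_; _≗_; refl; cong; cong₂; sym; trans; subst; module ≡-Reasoning)
  open import Relation.Nullary using (Dec; yes; no)
  open import Relation.Nullary.Decidable using (⌊_⌋; toWitness; fromWitness)
  open Sum ℕP.+-*-commutativeSemiring

  colourWeight : ∀ {ℓ} → List (Fin ℓ) → List ℕ → ℕ → ℕ
  colourWeight (q ∷ qs) (c ∷ cs) j = when ⌊ toℕ q ≟ j ⌋ c + colourWeight qs cs j
  colourWeight _        _        j = 0

  colourWeight-∉ : ∀ {ℓ} {i : Fin ℓ} qs cs → i ∉ qs → colourWeight qs cs (toℕ i) ≡ 0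
  colourWeight-∉ []       cs       i∉ = refl
  colourWeight-∉ (q ∷ qs) []       i∉ = refl
  colourWeight-∉ {i = i} (q ∷ qs) (c ∷ cs) i∉
    rewrite ⌊⌋-no (toℕ q ≟ toℕ i) (i∉ ∘ here ∘ sym ∘ FP.toℕ-injective) = colourWeight-∉ qs cs (i∉ ∘ there)

  colourWeight-here : ∀ {ℓ} {q : Fin ℓ} qs c cs → q ∉ qs → colourWeight (q ∷ qs) (c ∷ cs) (toℕ q) ≡ c
  colourWeight-here {q = q} qs c cs q∉
    rewrite ⌊⌋-yes (toℕ q ≟ toℕ q) refl | colourWeight-∉ qs cs q∉ = ℕP.+-identityʳ c

  colourWeight-there : ∀ {ℓ} {q i : Fin ℓ} qs c cs → i ≢ q → colourWeight (q ∷ qs) (c ∷ cs) (toℕ i) ≡ colourWeight qs cs (toℕ i)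
  colourWeight-there {q = q} {i} qs c cs i≢q rewrite ⌊⌋-no (toℕ q ≟ toℕ i) (i≢q ∘ sym ∘ FP.toℕ-injective) = refl

  available : ∀ {ℓ} → List (Fin ℓ) → List (Fin ℓ)
  available {ℓ} ps = filter (_∉? ps) (allFin ℓ)

  Realises : ∀ {ℓ} (L : Fin ℓ → ℕ) (ps qs : List (Fin ℓ)) (cs : List ℕ) → Bool
  Realises {ℓ} L ps qs cs = allB (λ i → ⌊ i ∈? ps ⌋ ∨ ⌊ colourWeight qs cs (toℕ i) ≟ L i ⌋) (allFin ℓ)

  T-Realises : ∀ {ℓ} (L : Fin ℓ → ℕ) ps qs cs → T (Realises L ps qs cs) ⇔ (∀ i → i ∉ ps → colourWeight qs cs (toℕ i) ≡ L i)
  T-Realises L ps qs cs = mk⇔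
    (λ t i i∉ → fromEach i i∉ (Equivalence.to 𝔹.T-∨ (Equivalence.to (T-allB-allFin _) t i)))
    (λ h → Equivalence.from (T-allB-allFin _) λ i → toEach i (h i))
    where
    fromEach : ∀ i → i ∉ ps → T ⌊ i ∈? ps ⌋ ⊎ T ⌊ colourWeight qs cs (toℕ i) ≟ L i ⌋ → colourWeight qs cs (toℕ i) ≡ L i
    fromEach i i∉ (inj₁ t) = ⊥-elim (i∉ (toWitness t))
    fromEach i i∉ (inj₂ t) = toWitness t
    toEach : ∀ i → (i ∉ ps → colourWeight qs cs (toℕ i) ≡ L i) → T (⌊ i ∈? ps ⌋ ∨ ⌊ colourWeight qs cs (toℕ i) ≟ L i ⌋)
    toEach i h with i ∈? ps
    ... | yes _  = _
    ... | no  i∉ = fromWitness (h i∉)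

  Realises-step : ∀ {ℓ} (L : Fin ℓ → ℕ) ps {q} qs c cs → q ∉ ps → q ∉ qs →
                  Realises L ps (q ∷ qs) (c ∷ cs) ≡ ⌊ L q ≟ c ⌋ ∧ Realises L (ps ++ q ∷ []) qs cs
  Realises-step L ps {q} qs c cs q∉ps q∉qs = T-injective
    (λ t → let h = Equivalence.to (T-Realises L ps (q ∷ qs) (c ∷ cs)) t in
       Equivalence.from 𝔹.T-∧ (fromWitness (trans (sym (h q q∉ps)) (colourWeight-here qs c cs q∉qs)) ,
         Equivalence.from (T-Realises L (ps ++ q ∷ []) qs cs) λ i i∉ →
           trans (sym (colourWeight-there qs c cs (i∉ ∘ ∈-++⁺ʳ ps ∘ here))) (h i (i∉ ∘ ∈-++⁺ˡ))))
    (λ t → let Lq≡c , t′ = Equivalence.to 𝔹.T-∧ t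
               h = Equivalence.to (T-Realises L (ps ++ q ∷ []) qs cs) t′ in
       Equivalence.from (T-Realises L ps (q ∷ qs) (c ∷ cs)) λ i i∉ps → case i F.≟ q of λ where
         (yes refl) → trans (colourWeight-here qs c cs q∉qs) (sym (toWitness Lq≡c))
         (no  i≢q)  → trans (colourWeight-there qs c cs i≢q) (h i λ i∈ → case ∈-++⁻ ps i∈ of λ where
                         (inj₁ i∈ps)        → i∉ps i∈ps
                         (inj₂ (here i≡q))  → i≢q i≡q))

  module _ {ℓ} {ps : List (Fin ℓ)} {q : Fin ℓ} where

    ∉-snoc⁺ : ∀ {y} → y ∉ ps → y ≢ q → y ∉ ps ++ q ∷ []
    ∉-snoc⁺ y∉ps y≢q y∈ with ∈-++⁻ ps y∈
    ... | inj₁ y∈ps       = y∉ps y∈ps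
    ... | inj₂ (here y≡q) = y≢q y≡q

    filter-∉?-snoc-absent : ∀ xs → q ∉ xs → filter (_∉? ps) xs ≡ filter (_∉? (ps ++ q ∷ [])) xs
    filter-∉?-snoc-absent []       _  = refl
    filter-∉?-snoc-absent (y ∷ ys) q∉ with y ∈? ps | y ∈? (ps ++ q ∷ [])
    ... | no  _    | no  _  = cong (y ∷_) (filter-∉?-snoc-absent ys (q∉ ∘ there))
    ... | yes _    | yes _  = filter-∉?-snoc-absent ys (q∉ ∘ there)
    ... | no  y∉ps | yes y∈′ = ⊥-elim (∉-snoc⁺ y∉ps (λ y≡q → q∉ (here (sym y≡q))) y∈′)
    ... | yes y∈ps | no  y∉′ = ⊥-elim (y∉′ (∈-++⁺ˡ y∈ps))

    filter-∉?-snoc : ∀ xs → Unique xs → q ∈ xs → q ∉ ps → filter (_∉? ps) xs ↭ q ∷ filter (_∉? (ps ++ q ∷ [])) xs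
    filter-∉?-snoc (y ∷ ys) (y∉ys ∷ !ys) (here refl) q∉ps with y ∈? ps | y ∈? (ps ++ q ∷ [])
    ... | yes q∈ps | _      = ⊥-elim (q∉ps q∈ps)
    ... | no  _    | no q∉  = ⊥-elim (q∉ (∈-++⁺ʳ ps (here refl)))
    ... | no  _    | yes _  = ↭-prep q (↭-reflexive (filter-∉?-snoc-absent ys λ q∈ys → All.lookup y∉ys q∈ys refl))
    filter-∉?-snoc (y ∷ ys) (y∉ys ∷ !ys) (there q∈ys) q∉ps with y ∈? ps | y ∈? (ps ++ q ∷ [])
    ... | no  _    | no  _   = ↭-trans (↭-prep y (filter-∉?-snoc ys !ys q∈ys q∉ps)) (↭-swap y q ↭-refl)
    ... | yes _    | yes _   = filter-∉?-snoc ys !ys q∈ys q∉ps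
    ... | no  y∉ps | yes y∈′ = ⊥-elim (∉-snoc⁺ y∉ps (All.lookup y∉ys q∈ys) y∈′)
    ... | yes y∈ps | no  y∉′ = ⊥-elim (y∉′ (∈-++⁺ˡ y∈ps))

  available-snoc : ∀ {ℓ} (L : Fin ℓ → ℕ) {ps q} → q ∉ ps → map L (available ps) ↭ L q ∷ map L (available (ps ++ q ∷ []))
  available-snoc {ℓ} L {q = q} q∉ps = ↭.map⁺ L (filter-∉?-snoc (allFin ℓ) (Unique.allFin⁺ ℓ) (∈-allFin q) q∉ps)

  occ-available : ∀ {ℓ} (L : Fin ℓ → ℕ) c ps →
                  occ c (map L (available ps)) ≡ ∑[ q ← allFin ℓ ] when ⌊ q ∉? ps ⌋ (when ⌊ L q ≟ c ⌋ 1)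
  occ-available {ℓ} L c ps = trans (occ-map L c (available ps)) (∑-filter (_∉? ps) (allFin ℓ) _)

  Realises-[] : ∀ {ℓ} (L : Fin ℓ → ℕ) → (∀ i → 1 ≤ L i) → ∀ ps →
                Realises L ps [] [] ≡ ⌊ [] ↭? map L (available ps) ⌋
  Realises-[] {ℓ} L pos ps = T-injective
    (λ t → let h = Equivalence.to (T-Realises L ps [] []) t in
       fromWitness (↭-reflexive (cong (map L) (sym (LP.filter-none (_∉? ps)
         (All.tabulate {xs = allFin ℓ} λ {i} _ i∉ → ℕP.<⇒≢ (pos i) (h i i∉)))))))
    (λ t → Equivalence.from (T-Realises L ps [] []) λ i i∉ →
       ⊥-elim (noneAvailable (↭.↭-empty-inv (↭-sym (toWitness t))) (∈-filter⁺ (_∉? ps) (∈-allFin i) i∉)))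
    where
    noneAvailable : ∀ {i} → map L (available ps) ≡ [] → i ∉ available ps
    noneAvailable eq i∈ with available ps
    noneAvailable () (here _)  | _ ∷ _
    noneAvailable () (there _) | _ ∷ _

  matchings-available-snoc : ∀ {ℓ} (L : Fin ℓ → ℕ) {ps q} cs → q ∉ ps →
    matchings cs (map L (available (ps ++ q ∷ []))) ≡ matchings cs (delete (L q) (map L (available ps)))
  matchings-available-snoc L cs q∉ps = matchings-↭ cs (↭.drop-∷ (↭-trans (↭-sym M↭) (delete-↭ (↭.∈-resp-↭ (↭-sym M↭) (here refl)))))
    where M↭ = available-snoc L q∉ps

  ∑-Realises-∷ : ∀ {ℓ} (L : Fin ℓ → ℕ) {ps q} → Unique ps → q ∉ ps → ∀ c cs →
    ∑[ qs ← arrangements (ps ++ q ∷ []) (length cs) ] when (Realises L ps (q ∷ qs) (c ∷ cs)) 1 ≡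
    when ⌊ L q ≟ c ⌋ (∑[ qs ← arrangements (ps ++ q ∷ []) (length cs) ] when (Realises L (ps ++ q ∷ []) qs cs) 1)
  ∑-Realises-∷ L {ps} {q} !ps q∉ps c cs = trans
    (∑-congᴬ (arrangements-unique (ps ++ q ∷ []) (length cs) (Unique-snoc !ps q∉ps)) λ qs (!ps+q+qs , _) →
      trans (cong (λ b → when b 1) (Realises-step L ps qs c cs q∉ps (Unique-++⁻ (ps ++ q ∷ []) !ps+q+qs (∈-++⁺ʳ ps (here refl)))))
            (when-∧ ⌊ L q ≟ c ⌋ _ 1))
    (sym (when-∑ ⌊ L q ≟ c ⌋ (arrangements (ps ++ q ∷ []) (length cs)) _))

  -- The first block, of weight c, can get any of the occ c M available colours of that weight.
  count-arrangements : ∀ {ℓ} (L : Fin ℓ → ℕ) → (∀ i → 1 ≤ L i) → ∀ cs ps → Unique ps →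
    ∑[ qs ← arrangements ps (length cs) ] when (Realises L ps qs cs) 1 ≡ matchings cs (map L (available ps))
  count-arrangements L pos [] ps !ps = trans (ℕP.+-identityʳ _)
    (trans (cong (λ b → when b 1) (Realises-[] L pos ps)) (noBlocks ([] ↭? map L (available ps))))
    where
    noBlocks : ∀ {M} (d : Dec ([] ↭ M)) → when ⌊ d ⌋ 1 ≡ when ⌊ d ⌋ (listFactor M)
    noBlocks (yes []↭M) = cong listFactor (sym (↭.↭-empty-inv (↭-sym []↭M)))
    noBlocks (no _)     = refl
  count-arrangements {ℓ} L pos (c ∷ cs) ps !ps = begin
    ∑[ qs ← arrangements ps (suc (length cs)) ] when (Realises L ps qs (c ∷ cs)) 1
      ≡⟨ ∑-arrangements-suc ps (length cs) _ ⟩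
    ∑[ q ← allFin ℓ ] when ⌊ q ∉? ps ⌋ (∑[ qs ← arrangements (ps ++ q ∷ []) (length cs) ] when (Realises L ps (q ∷ qs) (c ∷ cs)) 1)
      ≡⟨ ∑-cong (allFin ℓ) firstColour ⟩
    ∑[ q ← allFin ℓ ] when ⌊ q ∉? ps ⌋ (when ⌊ L q ≟ c ⌋ W)
      ≡⟨ ∑-cong (allFin ℓ) (λ q → factorOut ⌊ q ∉? ps ⌋ ⌊ L q ≟ c ⌋) ⟩
    ∑[ q ← allFin ℓ ] (when ⌊ q ∉? ps ⌋ (when ⌊ L q ≟ c ⌋ 1) * W)
      ≡⟨ *-distribʳ-∑ (allFin ℓ) W _ ⟨
    (∑[ q ← allFin ℓ ] when ⌊ q ∉? ps ⌋ (when ⌊ L q ≟ c ⌋ 1)) * W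
      ≡⟨ cong (_* W) (occ-available L c ps) ⟨
    occ c M * W
      ≡⟨ matchings-∷ c cs M ⟨
    matchings (c ∷ cs) M ∎
    where
    open ≡-Reasoning
    M = map L (available ps)
    W = matchings cs (delete c M)
    factorOut : ∀ a b → when a (when b W) ≡ when a (when b 1) * W
    factorOut a b = trans (sym (when-∧ a b W)) (trans (when-*ʳ (a ∧ b) W) (cong (_* W) (when-∧ a b 1)))
    firstColour : ∀ q → when ⌊ q ∉? ps ⌋ (∑[ qs ← arrangements (ps ++ q ∷ []) (length cs) ] when (Realises L ps (q ∷ qs) (c ∷ cs)) 1)
                      ≡ when ⌊ q ∉? ps ⌋ (when ⌊ L q ≟ c ⌋ W)
    firstColour q with q ∈? ps
    ... | yes _    = refl
    ... | no q∉ps = trans (∑-Realises-∷ L !ps q∉ps c cs) (trans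
      (cong (when ⌊ L q ≟ c ⌋) (trans (count-arrangements L pos cs (ps ++ q ∷ []) (Unique-snoc !ps q∉ps))
                                      (matchings-available-snoc L cs q∉ps)))
      (when-≟ ℕ._≟_ (λ k → matchings cs (delete k M)) {L q} {c}))

module ChromaticCoefficients where
  open Sums
  open Multisets
  open Standardisation
  open ArrangementCounts
  open import Data.Bool using (Bool; true; false; T; _∧_; _∨_; not)
  open import Data.Fin as F using (Fin; toℕ)
  open import Data.List using (List; []; _∷_; map; filter; length; allFin; upTo; lookup; tabulate)
  open import Data.List.Membership.Propositional using (_∈_; _∉_)
  open import Data.List.Membership.Propositional.Properties using (∈-allFin; ∈-upTo⁺; ∈-upTo⁻; ∈-lookup)
  import Data.List.Properties as LP
  open import Data.List.Relation.Binary.Permutation.Propositional using (_↭_)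
  open import Data.List.Relation.Unary.All as All using (All; []; _∷_)
  import Data.List.Relation.Unary.All.Properties as All
  open import Data.List.Relation.Unary.Any using (here; there)
  open import Data.List.Relation.Unary.Unique.Propositional using (Unique; []; _∷_)
  import Data.List.Relation.Unary.Unique.Propositional.Properties as Unique
  open import Data.Nat as ℕ using (ℕ; suc; _+_; _*_; _≤_; _<_; _≟_; z≤n)
  open import Data.Nat.ListAction using (sum)
  import Data.Nat.Properties as ℕP
  open import Data.Product using (_,_)
  open import Function using (_∘_; _⇔_; mk⇔)
  open import Relation.Binary.PropositionalEquality
    using (_≡_; _≢_; _≗_; refl; cong; cong₂; sym; trans; subst; module ≡-Reasoning)
  open import Relation.Nullary.Decidable using (⌊_⌋)
  open Sum ℕP.+-*-commutativeSemiring

  count≡∑ : ∀ {A : Set} (p : A → Bool) xs → count p xs ≡ ∑[ x ← xs ] when (p x) 1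
  count≡∑ p []       = refl
  count≡∑ p (x ∷ xs) with p x
  ... | true  = cong suc (count≡∑ p xs)
  ... | false = count≡∑ p xs

  ∑-upTo-shift : ∀ N (g : ℕ → ℕ) → ∑ (upTo (suc N)) g ≡ g 0 + ∑[ b ← upTo N ] g (suc b)
  ∑-upTo-shift N g = cong (g 0 +_) (trans (cong (λ is → ∑ is g) (sym (LP.map-upTo suc N))) (∑-map (upTo N) suc g))

  colourWeight-applyUpTo : ∀ {ℓ} (qs : List (Fin ℓ)) (g : ℕ → ℕ) j →
    colourWeight qs (Data.List.applyUpTo g (length qs)) j ≡ ∑[ b ← upTo (length qs) ] when ⌊ colourAt qs b ≟ j ⌋ (g b)
  colourWeight-applyUpTo []       g j = refl
  colourWeight-applyUpTo (q ∷ qs) g j = trans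
    (cong (when ⌊ toℕ q ≟ j ⌋ (g 0) +_) (colourWeight-applyUpTo qs (g ∘ suc) j))
    (sym (∑-upTo-shift (length qs) λ b → when ⌊ colourAt (q ∷ qs) b ≟ j ⌋ (g b)))

  module WeightsOf (G : WGraph) where
    open ColouringsOf G

    isProperℕ-∘ : ∀ (g : ℕ → ℕ) h → (∀ u v → g (h u) ≡ g (h v) → h u ≡ h v) → isProperℕ (g ∘ h) ≡ isProperℕ h
    isProperℕ-∘ g h inj = allB-cong (allFin (n G)) λ u → allB-cong (allFin (n G)) λ v →
      cong (λ b → not (adj G u v) ∨ not b) (⌊⌋-⇔ (mk⇔ (inj u v) (cong g)) (g (h u) ≟ g (h v)) (h u ≟ h v))

    classWeightℕ-∘ : ∀ (g : ℕ → ℕ) h N → (∀ v → h v < N) → ∀ j →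
                     classWeightℕ (g ∘ h) j ≡ ∑[ b ← upTo N ] when ⌊ g b ≟ j ⌋ (classWeightℕ h b)
    classWeightℕ-∘ g h N h<N j = begin
      ∑[ v ← allFin (n G) ] when ⌊ g (h v) ≟ j ⌋ (w G v)
        ≡⟨ ∑-cong (allFin (n G)) (λ v → sym (∑-δ′ ℕ._≟_ (λ b → when ⌊ g b ≟ j ⌋ (w G v)) (Unique.upTo⁺ N) (∈-upTo⁺ (h<N v)))) ⟩
      ∑[ v ← allFin (n G) ] ∑[ b ← upTo N ] when ⌊ h v ≟ b ⌋ (when ⌊ g b ≟ j ⌋ (w G v))
        ≡⟨ ∑-comm (allFin (n G)) (upTo N) _ ⟩
      ∑[ b ← upTo N ] ∑[ v ← allFin (n G) ] when ⌊ h v ≟ b ⌋ (when ⌊ g b ≟ j ⌋ (w G v))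
        ≡⟨ ∑-cong (upTo N) (λ b → trans (∑-cong (allFin (n G)) λ v → when-comm ⌊ h v ≟ b ⌋ ⌊ g b ≟ j ⌋ (w G v))
                                        (sym (when-∑ ⌊ g b ≟ j ⌋ (allFin (n G)) λ v → when ⌊ h v ≟ b ⌋ (w G v)))) ⟩
      ∑[ b ← upTo N ] when ⌊ g b ≟ j ⌋ (classWeightℕ h b) ∎
      where open ≡-Reasoning

    blockWeightList : (Fin (n G) → Fin (n G)) → List ℕ
    blockWeightList f = map (classWeightℕ (toℕ ∘ f)) (upTo (blocksFrom 0 f))

    blockWeights≡toPartition : ∀ f → blockWeights G f ≡ toPartition (blockWeightList f)
    blockWeights≡toPartition f = cong toPartition (begin
      map (λ b → sum (map (w G) (filter (λ v → toℕ (f v) ≟ b) (allFin (n G))))) (upTo (numBlocks f))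
        ≡⟨ LP.map-cong (λ b → ∑-filter (λ v → toℕ (f v) ≟ b) (allFin (n G)) (w G)) (upTo (numBlocks f)) ⟩
      map (classWeightℕ (toℕ ∘ f)) (upTo (numBlocks f))
        ≡⟨ cong (map (classWeightℕ (toℕ ∘ f)) ∘ upTo) (numBlocks≡blocksFrom0 f) ⟩
      blockWeightList f ∎)
      where open ≡-Reasoning

    blockWeightList-pos : ∀ f → T (isRGFFrom 0 f) → All (1 ≤_) (blockWeightList f)
    blockWeightList-pos f rgf = All.map⁺ (All.tabulate λ {b} b∈ →
      let v , fv≡b = isRGFFrom-surjective 0 f rgf z≤n (∈-upTo⁻ b∈) in
      ℕP.≤-trans (w-pos G v) (ℕP.≤-trans (ℕP.≤-reflexive (sym (cong (λ c → when c (w G v)) (⌊⌋-yes (toℕ (f v) ≟ b) fv≡b))))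
                                         (≤-∑ (λ u → when ⌊ toℕ (f u) ≟ b ⌋ (w G u)) (∈-allFin v))))
      where
      ≤-∑ : ∀ {A : Set} {x : A} {xs} (g : A → ℕ) → x ∈ xs → g x ≤ ∑ xs g
      ≤-∑ g (here refl)          = ℕP.m≤m+n _ _
      ≤-∑ {xs = y ∷ ys} g (there x∈) = ℕP.≤-trans (≤-∑ g x∈) (ℕP.m≤n+m _ (g y))

  when-T : ∀ b {x y} → (T b → x ≡ y) → when b x ≡ when b y
  when-T true  x≡y = x≡y _
  when-T false _   = refl

  module CoefficientOf (G : WGraph) (λ' : Partition) where
    open ColouringsOf G
    open WeightsOf G

    ps : List ℕ
    ps = parts λ'

    L : Fin (length ps) → ℕ
    L = lookup ps

    L-pos : ∀ i → 1 ≤ L i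
    L-pos i = All.lookup (parts-pos λ') (∈-lookup i)

    isValid : (Fin (n G) → ℕ) → Bool
    isValid h = isProperℕ h ∧ allB (λ i → ⌊ classWeightℕ h (toℕ i) ≟ L i ⌋) (allFin (length ps))

    valid : (Fin (n G) → ℕ) → ℕ
    valid h = when (isValid h) 1

    valid-ext : Extensional valid
    valid-ext h≗h′ = cong (λ b → when b 1) (cong₂ _∧_ (isProperℕ-cong h≗h′)
      (allB-cong (allFin (length ps)) λ i → cong (λ k → ⌊ k ≟ L i ⌋) (classWeightℕ-cong h≗h′ (toℕ i))))

    coeffX≡∑valid : coeffX G λ' ≡ ∑[ κ ← allFuns (n G) (length ps) ] valid (toℕ ∘ κ)
    coeffX≡∑valid = trans (count≡∑ _ (allFuns (n G) (length ps))) (∑-cong (allFuns (n G) (length ps)) λ κ →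
      cong (λ b → when b 1) (cong₂ _∧_ (isProper-toℕ κ)
        (allB-cong (allFin (length ps)) λ i → cong (λ k → ⌊ k ≟ L i ⌋) (classWeight-toℕ κ i))))

    valid-relabel : ∀ f qs → Unique qs → length qs ≡ blocksFrom 0 f →
                    valid (colourAt qs ∘ toℕ ∘ f) ≡ when (isProper G f) (when (Realises L [] qs (blockWeightList f)) 1)
    valid-relabel f qs !qs len = trans (cong (λ b → when b 1) (cong₂ _∧_ proper weights)) (when-∧ (isProper G f) _ 1)
      where
      labels< : ∀ v → toℕ (f v) < length qs
      labels< v = subst (toℕ (f v) <_) (sym len) (label<blocksFrom 0 f v)
      proper : isProperℕ (colourAt qs ∘ toℕ ∘ f) ≡ isProper G f
      proper = trans (isProperℕ-∘ (colourAt qs) (toℕ ∘ f) λ u v → colourAt-injective !qs (labels< u) (labels< v))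
                     (sym (isProper-toℕ f))
      weights : allB (λ i → ⌊ classWeightℕ (colourAt qs ∘ toℕ ∘ f) (toℕ i) ≟ L i ⌋) (allFin (length ps)) ≡
                Realises L [] qs (blockWeightList f)
      weights = allB-cong (allFin (length ps)) λ i → cong (λ k → ⌊ k ≟ L i ⌋) (begin
        classWeightℕ (colourAt qs ∘ toℕ ∘ f) (toℕ i)
          ≡⟨ classWeightℕ-∘ (colourAt qs) (toℕ ∘ f) (length qs) labels< (toℕ i) ⟩
        ∑[ b ← upTo (length qs) ] when ⌊ colourAt qs b ≟ toℕ i ⌋ (classWeightℕ (toℕ ∘ f) b)
          ≡⟨ colourWeight-applyUpTo qs (classWeightℕ (toℕ ∘ f)) (toℕ i) ⟨
        colourWeight qs (Data.List.applyUpTo (classWeightℕ (toℕ ∘ f)) (length qs)) (toℕ i)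
          ≡⟨ cong (λ cs → colourWeight qs cs (toℕ i)) (LP.map-upTo (classWeightℕ (toℕ ∘ f)) (length qs)) ⟨
        colourWeight qs (map (classWeightℕ (toℕ ∘ f)) (upTo (length qs))) (toℕ i)
          ≡⟨ cong (λ N → colourWeight qs (map (classWeightℕ (toℕ ∘ f)) (upTo N)) (toℕ i)) len ⟩
        colourWeight qs (blockWeightList f) (toℕ i) ∎)
        where open ≡-Reasoning

    available-[] : map L (available []) ≡ ps
    available-[] = begin
      map L (filter (_∉? []) (allFin (length ps))) ≡⟨ cong (map L) (LP.filter-all (_∉? []) (All.tabulate λ _ ())) ⟩
      map L (allFin (length ps))                    ≡⟨ LP.map-tabulate (λ i → i) L ⟩
      tabulate L                                    ≡⟨ LP.tabulate-lookup ps ⟩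
      ps                                            ∎
      where open ≡-Reasoning

    ∑-valid-relabel : ∀ f → T (isRGFFrom 0 f) →
      ∑[ qs ← arrangements [] (blocksFrom 0 f) ] valid (colourAt qs ∘ toℕ ∘ f) ≡
      when (isProper G f ∧ ⌊ blockWeights G f ≟ₚ λ' ⌋) (factor λ')
    ∑-valid-relabel f rgf = begin
      ∑[ qs ← arrangements [] N ] valid (colourAt qs ∘ toℕ ∘ f)
        ≡⟨ ∑-congᴬ (arrangements-unique [] N []) (λ qs (!qs , len) → valid-relabel f qs !qs len) ⟩
      ∑[ qs ← arrangements [] N ] when (isProper G f) (when (Realises L [] qs cs) 1)
        ≡⟨ when-∑ (isProper G f) (arrangements [] N) _ ⟨
      when (isProper G f) (∑[ qs ← arrangements [] N ] when (Realises L [] qs cs) 1)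
        ≡⟨ cong (λ k → when (isProper G f) (∑[ qs ← arrangements [] k ] when (Realises L [] qs cs) 1)) length-cs ⟨
      when (isProper G f) (∑[ qs ← arrangements [] (length cs) ] when (Realises L [] qs cs) 1)
        ≡⟨ cong (when (isProper G f)) (count-arrangements L L-pos cs [] []) ⟩
      when (isProper G f) (matchings cs (map L (available [])))
        ≡⟨ cong (when (isProper G f)) (cong₂ when sameWeights (trans (cong listFactor available-[]) (sym (factor≡listFactor λ')))) ⟩
      when (isProper G f) (when ⌊ blockWeights G f ≟ₚ λ' ⌋ (factor λ'))
        ≡⟨ when-∧ (isProper G f) _ (factor λ') ⟨
      when (isProper G f ∧ ⌊ blockWeights G f ≟ₚ λ' ⌋) (factor λ') ∎
      where
      open ≡-Reasoning
      N = blocksFrom 0 f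
      cs = blockWeightList f
      length-cs : length cs ≡ N
      length-cs = trans (LP.length-map _ (upTo N)) (LP.length-upTo N)
      sameWeights : ⌊ cs ↭? map L (available []) ⌋ ≡ ⌊ blockWeights G f ≟ₚ λ' ⌋
      sameWeights = begin
        ⌊ cs ↭? map L (available []) ⌋ ≡⟨ cong (λ M → ⌊ cs ↭? M ⌋) available-[] ⟩
        ⌊ cs ↭? ps ⌋                   ≡⟨ ⌊⌋-⇔ (parts-toPartition≡⇔↭ (blockWeightList-pos f rgf) λ') (toPartition cs ≟ₚ λ') (cs ↭? ps) ⟨
        ⌊ toPartition cs ≟ₚ λ' ⌋       ≡⟨ cong (λ μ → ⌊ μ ≟ₚ λ' ⌋) (blockWeights≡toPartition f) ⟨
        ⌊ blockWeights G f ≟ₚ λ' ⌋     ∎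

    coeffX≡factor*numSt : coeffX G λ' ≡ factor λ' * numSt G λ'
    coeffX≡factor*numSt = begin
      coeffX G λ'
        ≡⟨ coeffX≡∑valid ⟩
      ∑[ κ ← allFuns (n G) (length ps) ] valid (toℕ ∘ κ)
        ≡⟨ ∑-standardise (n G) (n G) [] 0 refl [] ℕP.≤-refl valid valid-ext ⟩
      standardSum (n G) [] 0 valid
        ≡⟨ ∑-cong (allFuns (n G) (n G)) (λ f → trans
             (when-T (isRGFFrom 0 f) (∑-valid-relabel f)) (sym (when-∧ (isRGFFrom 0 f) _ (factor λ')))) ⟩
      ∑[ f ← allFuns (n G) (n G) ] when (isRGFFrom 0 f ∧ (isProper G f ∧ ⌊ blockWeights G f ≟ₚ λ' ⌋)) (factor λ')
        ≡⟨ ∑-cong (allFuns (n G) (n G)) (λ f → let P = isProper G f ∧ ⌊ blockWeights G f ≟ₚ λ' ⌋ in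
             trans (cong (λ b → when (b ∧ P) (factor λ')) (sym (isRGF≡isRGFFrom0 f)))
                   (trans (when-*ʳ (isRGF f ∧ P) (factor λ')) (ℕP.*-comm _ (factor λ')))) ⟩
      ∑[ f ← allFuns (n G) (n G) ] (factor λ' * when (isRGF f ∧ blocksStable G f ∧ ⌊ blockWeights G f ≟ₚ λ' ⌋) 1)
        ≡⟨ *-distribˡ-∑ (allFuns (n G) (n G)) (factor λ') _ ⟨
      factor λ' * ∑[ f ← allFuns (n G) (n G) ] when (isRGF f ∧ blocksStable G f ∧ ⌊ blockWeights G f ≟ₚ λ' ⌋) 1
        ≡⟨ cong (factor λ' *_) (count≡∑ _ (allFuns (n G) (n G))) ⟨
      factor λ' * numSt G λ' ∎
      where open ≡-Reasoning

module ChromaticCharacters where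
  open Multisets
  open Characters
  open ChromaticCoefficients
  open import Data.List using (map)
  import Data.Nat as ℕ
  import Relation.Binary.PropositionalEquality as ≡

  module _ {c ℓ} (K : Field c ℓ) where
    open Field K
    open FieldOps K
    open SymFun K
    open CharacterTheory K
    open import Relation.Binary.Reasoning.Setoid setoid
    open import Algebra.Properties.CommutativeSemigroup *-commutativeSemigroup using (xy∙z≈y∙xz)

    chromatic-productFormula : ∀ (ζ : Character) (G : WGraph) →
      ev (proj₁ ζ) (X G) ≈ ∑[ λ' ← partitionsOf (totalWeight G) ] (fromℕ (numSt G λ') * Πᴷ (map (sequenceOf (proj₁ ζ)) (parts λ')))
    chromatic-productFormula ζ G =
      trans (≡⇒≈ (∑-map (partitionsOf (totalWeight G)) _ _)) (∑-cong (partitionsOf (totalWeight G)) λ λ' → begin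
      fromℕ (coeffX G λ') * proj₁ ζ λ'                          ≡⟨ ≡.cong (λ k → fromℕ k * proj₁ ζ λ') (CoefficientOf.coeffX≡factor*numSt G λ') ⟩
      fromℕ (factor λ' ℕ.* numSt G λ') * proj₁ ζ λ'              ≈⟨ *-congʳ (fromℕ-* (factor λ') (numSt G λ')) ⟩
      fromℕ (factor λ') * fromℕ (numSt G λ') * proj₁ ζ λ'        ≈⟨ xy∙z≈y∙xz _ _ _ ⟩
      fromℕ (numSt G λ') * (fromℕ (factor λ') * proj₁ ζ λ')      ≈⟨ *-congˡ (ev-m̃-factor (proj₁ ζ) λ') ⟨
      fromℕ (numSt G λ') * ev (proj₁ ζ) (m̃ λ')                  ≈⟨ *-congˡ (character-productFormula ζ λ') ⟩
      fromℕ (numSt G λ') * Πᴷ (map (sequenceOf (proj₁ ζ)) (parts λ')) ∎)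

module SplitCounts where
  open Sums
  open Multisets
  open import Data.Bool using (Bool; _∧_; if_then_else_)
  open import Data.Bool.ListAction using (and)
  import Data.Bool.Properties as 𝔹
  open import Data.List using (List; []; _∷_; _++_; map; concatMap; upTo)
  open import Data.List.Membership.Propositional using (_∈_; _∉_)
  open import Data.List.Membership.Propositional.Properties using (∈-upTo⁺; ∈-upTo⁻)
  import Data.List.Properties as LP
  open import Data.List.Relation.Binary.Permutation.Propositional using (_↭_; ↭-refl; ↭-sym; ↭-trans)
  import Data.List.Relation.Binary.Permutation.Propositional.Properties as ↭
  open import Data.List.Relation.Unary.All as All using (All; []; _∷_)
  import Data.List.Relation.Unary.All.Properties as All
  open import Data.List.Relation.Unary.Unique.Propositional using (Unique; []; _∷_)
  import Data.List.Relation.Unary.Unique.Propositional.Properties as Unique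
  open import Data.Nat as ℕ using (ℕ; zero; suc; _+_; _*_; _∸_; _≤_; _<_; _≤?_; _<?_; _≟_; _⊔_; s≤s)
  open import Data.Nat.ListAction using (sum)
  import Data.Nat.Properties as ℕP
  open import Data.Product using (_×_; _,_; proj₁; proj₂; map₁; map₂)
  open import Function using (_∘_; _⇔_; mk⇔; Equivalence)
  open import Relation.Binary.PropositionalEquality
    using (_≡_; _≢_; _≗_; refl; cong; cong₂; sym; trans; subst; module ≡-Reasoning)
  open import Relation.Nullary using (Dec; yes; no)
  open import Relation.Nullary.Decidable using (⌊_⌋; toWitness; fromWitness)
  import Algebra.Properties.CommutativeSemigroup ℕP.*-commutativeSemigroup as ℕ*
  open import Data.List.Membership.DecPropositional ℕ._≟_ using () renaming (_∈?_ to _∈ℕ?_)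
  open Sum ℕP.+-*-commutativeSemiring

  occ-*-cong : ∀ x us {a b} → (x ∈ us → a ≡ b) → occ x us * a ≡ occ x us * b
  occ-*-cong x us a≡b with x ∈ℕ? us
  ... | yes x∈us = cong (occ x us *_) (a≡b x∈us)
  ... | no  x∉us rewrite occ-∉ x∉us = refl

  -- ∏ᵢ rᵢ(us ⊔ vs)! = #{ways to split us ⊔ vs into us and vs} · ∏ᵢ rᵢ(us)! · ∏ᵢ rᵢ(vs)!
  ∑-splits-matchings : ∀ xs {us vs} → xs ↭ us ++ vs → ∑[ s ← splits xs ] (matchings (proj₁ s) us * matchings (proj₂ s) vs) ≡ listFactor xs
  ∑-splits-matchings [] {us} {vs} []↭ with LP.++-conicalˡ us vs (↭.↭-empty-inv (↭-sym []↭)) | LP.++-conicalʳ us vs (↭.↭-empty-inv (↭-sym []↭))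
  ... | refl | refl rewrite ⌊⌋-yes ([] ↭? []) ↭-refl = refl
  ∑-splits-matchings (x ∷ xs) {us} {vs} x∷xs↭ = begin
    ∑ (splits (x ∷ xs)) term
      ≡⟨ ∑-++ (map (map₁ (x ∷_)) (splits xs)) _ term ⟩
    ∑ (map (map₁ (x ∷_)) (splits xs)) term + ∑ (map (map₂ (x ∷_)) (splits xs)) term
      ≡⟨ cong₂ _+_ (∑-map (splits xs) (map₁ (x ∷_)) term) (∑-map (splits xs) (map₂ (x ∷_)) term) ⟩
    ∑[ s ← splits xs ] term (map₁ (x ∷_) s) + ∑[ s ← splits xs ] term (map₂ (x ∷_) s)
      ≡⟨ cong₂ _+_ (left x∷xs↭) (right x∷xs↭) ⟩
    occ x us * listFactor xs + occ x vs * listFactor xs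
      ≡⟨ ℕP.*-distribʳ-+ (listFactor xs) (occ x us) (occ x vs) ⟨
    (occ x us + occ x vs) * listFactor xs
      ≡⟨ cong (_* listFactor xs) (trans (sym (occ-++ x us vs)) (trans (occ-↭ x (↭-sym x∷xs↭)) (occ-here x xs))) ⟩
    suc (occ x xs) * listFactor xs ∎
    where
    open ≡-Reasoning
    term : List ℕ × List ℕ → ℕ
    term s = matchings (proj₁ s) us * matchings (proj₂ s) vs
    left : x ∷ xs ↭ us ++ vs → ∑[ s ← splits xs ] term (map₁ (x ∷_) s) ≡ occ x us * listFactor xs
    left p = begin
      ∑[ s ← splits xs ] (matchings (x ∷ proj₁ s) us * matchings (proj₂ s) vs)
        ≡⟨ ∑-cong (splits xs) (λ s → trans (cong (_* matchings (proj₂ s) vs) (matchings-∷ x (proj₁ s) us)) (ℕP.*-assoc (occ x us) _ _)) ⟩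
      ∑[ s ← splits xs ] (occ x us * (matchings (proj₁ s) (delete x us) * matchings (proj₂ s) vs))
        ≡⟨ *-distribˡ-∑ (splits xs) (occ x us) _ ⟨
      occ x us * ∑[ s ← splits xs ] (matchings (proj₁ s) (delete x us) * matchings (proj₂ s) vs)
        ≡⟨ occ-*-cong x us (λ x∈us → ∑-splits-matchings xs (↭.drop-∷ (↭-trans p (↭.++⁺ʳ vs (delete-↭ x∈us))))) ⟩
      occ x us * listFactor xs ∎
    right : x ∷ xs ↭ us ++ vs → ∑[ s ← splits xs ] term (map₂ (x ∷_) s) ≡ occ x vs * listFactor xs
    right p = begin
      ∑[ s ← splits xs ] (matchings (proj₁ s) us * matchings (x ∷ proj₂ s) vs)
        ≡⟨ ∑-cong (splits xs) (λ s → trans (cong (matchings (proj₁ s) us *_) (matchings-∷ x (proj₂ s) vs)) (ℕ*.x∙yz≈y∙xz (matchings (proj₁ s) us) (occ x vs) _)) ⟩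
      ∑[ s ← splits xs ] (occ x vs * (matchings (proj₁ s) us * matchings (proj₂ s) (delete x vs)))
        ≡⟨ *-distribˡ-∑ (splits xs) (occ x vs) _ ⟨
      occ x vs * ∑[ s ← splits xs ] (matchings (proj₁ s) us * matchings (proj₂ s) (delete x vs))
        ≡⟨ occ-*-cong x vs (λ x∈vs → ∑-splits-matchings xs (↭.drop-∷ (↭-trans p (↭-trans (↭.++⁺ˡ us (delete-↭ x∈vs)) (↭.shift x us _))))) ⟩
      occ x vs * listFactor xs ∎

  open import Data.List.Relation.Unary.Sorted.TotalOrder ℕP.≤-totalOrder using (Sorted)
  open import Data.List.Relation.Unary.Linked using ([]; [-]; _∷_)

  IncreasingFrom : ℕ → List ℕ → Set
  IncreasingFrom lo xs = Sorted xs × All (1 ≤_) xs × All (lo ≤_) xs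

  IncreasingFrom-∷ : ∀ {lo k ys} → lo ≤ k → 1 ≤ k → IncreasingFrom k ys → IncreasingFrom lo (k ∷ ys)
  IncreasingFrom-∷ lo≤k 1≤k (sorted , pos , k≤ys) =
    sorted∷ sorted k≤ys , 1≤k ∷ pos , lo≤k ∷ All.map (ℕP.≤-trans lo≤k) k≤ys
    where
    sorted∷ : ∀ {k ys} → Sorted ys → All (k ≤_) ys → Sorted (k ∷ ys)
    sorted∷ []        []          = [-]
    sorted∷ {ys = _ ∷ _} s (k≤y ∷ _) = k≤y ∷ s

  IncreasingFrom-∷⁻ : ∀ {lo t ts} → IncreasingFrom lo (t ∷ ts) → lo ≤ t × 1 ≤ t × IncreasingFrom t ts
  IncreasingFrom-∷⁻ (sorted , 1≤t ∷ pos , lo≤t ∷ _) = lo≤t , 1≤t , tail sorted , pos , lowerBound sorted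
    where
    tail : ∀ {t ts} → Sorted (t ∷ ts) → Sorted ts
    tail [-]     = []
    tail (_ ∷ s) = s
    lowerBound : ∀ {t ts} → Sorted (t ∷ ts) → All (t ≤_) ts
    lowerBound [-]       = []
    lowerBound (t≤ ∷ s) = t≤ ∷ All.map (ℕP.≤-trans t≤) (lowerBound s)

  incLists-increasing : ∀ f lo n → All (IncreasingFrom lo) (incLists f lo n)
  incLists-increasing f       lo zero    = ([] , [] , []) ∷ []
  incLists-increasing zero    lo (suc n) = []
  incLists-increasing (suc f) lo (suc n) = concatMap⁺ (upTo (suc (suc n))) step
    where
    concatMap⁺ : ∀ {A B : Set} {P : B → Set} {g : A → List B} xs → (∀ x → All P (g x)) → All P (concatMap g xs)
    concatMap⁺ []       h = []
    concatMap⁺ (x ∷ xs) h = All.++⁺ (h x) (concatMap⁺ xs h)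
    step : ∀ k → All (IncreasingFrom lo) (if ⌊ lo ≤? k ⌋ ∧ ⌊ 1 ≤? k ⌋ then map (k ∷_) (incLists f k (suc n ∸ k)) else [])
    step k with lo ≤? k | 1 ≤? k
    ... | yes lo≤k | yes 1≤k = All.map⁺ (All.map (IncreasingFrom-∷ lo≤k 1≤k) (incLists-increasing f k (suc n ∸ k)))
    ... | yes _    | no  _   = []
    ... | no  _    | _       = []

  infix 4 _≡ˡ?_
  _≡ˡ?_ : (xs ys : List ℕ) → Dec (xs ≡ ys)
  _≡ˡ?_ = LP.≡-dec ℕ._≟_

  ∑-incLists-suc : ∀ f lo n (g : List ℕ → ℕ) → ∑ (incLists (suc f) lo (suc n)) g ≡
    ∑[ k ← upTo (suc (suc n)) ] when (⌊ lo ≤? k ⌋ ∧ ⌊ 1 ≤? k ⌋) (∑[ ys ← incLists f k (suc n ∸ k) ] g (k ∷ ys))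
  ∑-incLists-suc f lo n g = trans (∑-concatMap (upTo (suc (suc n))) pieces g) (∑-cong (upTo (suc (suc n))) λ k →
    trans (∑-if-[] (⌊ lo ≤? k ⌋ ∧ ⌊ 1 ≤? k ⌋) _ g) (cong (when _) (∑-map (incLists f k (suc n ∸ k)) (k ∷_) g)))
    where
    pieces : ℕ → List (List ℕ)
    pieces k = if ⌊ lo ≤? k ⌋ ∧ ⌊ 1 ≤? k ⌋ then map (k ∷_) (incLists f k (suc n ∸ k)) else []

  ∷≡ˡ?∷ : ∀ x xs y ys → ⌊ x ∷ xs ≡ˡ? y ∷ ys ⌋ ≡ ⌊ y ≟ x ⌋ ∧ ⌊ xs ≡ˡ? ys ⌋
  ∷≡ˡ?∷ x xs y ys = T-injective
    (λ eq → let x≡y , xs≡ys = LP.∷-injective (toWitness {a? = x ∷ xs ≡ˡ? y ∷ ys} eq) in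
            Equivalence.from (𝔹.T-∧ {⌊ y ≟ x ⌋}) (fromWitness {a? = y ≟ x} (sym x≡y) , fromWitness {a? = xs ≡ˡ? ys} xs≡ys))
    (λ both → let y≡x , xs≡ys = Equivalence.to (𝔹.T-∧ {⌊ y ≟ x ⌋}) both in
              fromWitness {a? = x ∷ xs ≡ˡ? y ∷ ys} (cong₂ _∷_ (sym (toWitness y≡x)) (toWitness xs≡ys)))

  ∑-incLists : ∀ f lo n ts → n ≤ f → IncreasingFrom lo ts →
               ∑[ xs ← incLists f lo n ] when ⌊ ts ≡ˡ? xs ⌋ 1 ≡ when ⌊ sum ts ≟ n ⌋ 1
  ∑-incLists f lo zero [] _ _ = refl
  ∑-incLists f lo zero (t ∷ ts) _ (_ , 1≤t ∷ _ , _) =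
    sym (cong (λ b → when b 1) (⌊⌋-no (sum (t ∷ ts) ≟ 0) (ℕP.<⇒≢ (ℕP.≤-trans 1≤t (ℕP.m≤m+n t (sum ts))) ∘ sym)))
  ∑-incLists zero lo (suc n) ts () _
  ∑-incLists (suc f) lo (suc n) [] _ _ = trans (∑-incLists-suc f lo n _) (trans
    (∑-cong (upTo (suc (suc n))) λ k → let allowed = ⌊ lo ≤? k ⌋ ∧ ⌊ 1 ≤? k ⌋ in
      trans (cong (when allowed) (∑-zero (incLists f k (suc n ∸ k)))) (when-zero allowed))
    (∑-zero (upTo (suc (suc n)))))
  ∑-incLists (suc f) lo (suc n) (t ∷ ts) (s≤s n≤f) inc with IncreasingFrom-∷⁻ inc
  ... | lo≤t , 1≤t , incTs = begin
    ∑[ xs ← incLists (suc f) lo (suc n) ] when ⌊ t ∷ ts ≡ˡ? xs ⌋ 1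
      ≡⟨ ∑-incLists-suc f lo n _ ⟩
    ∑[ k ← upTo (suc (suc n)) ] when (allowed k) (∑[ ys ← incLists f k (suc n ∸ k) ] when ⌊ t ∷ ts ≡ˡ? k ∷ ys ⌋ 1)
      ≡⟨ ∑-cong (upTo (suc (suc n))) (λ k → trans (cong (when (allowed k)) (firstEntry k)) (when-comm (allowed k) ⌊ k ≟ t ⌋ (rest k))) ⟩
    ∑[ k ← upTo (suc (suc n)) ] when ⌊ k ≟ t ⌋ (when (allowed k) (rest k))
      ≡⟨ atFirstEntry (t <? suc (suc n)) ⟩
    when ⌊ t + sum ts ≟ suc n ⌋ 1 ∎
    where
    open ≡-Reasoning
    allowed : ℕ → Bool
    allowed k = ⌊ lo ≤? k ⌋ ∧ ⌊ 1 ≤? k ⌋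
    rest : ℕ → ℕ
    rest k = ∑[ ys ← incLists f k (suc n ∸ k) ] when ⌊ ts ≡ˡ? ys ⌋ 1
    firstEntry : ∀ k → ∑[ ys ← incLists f k (suc n ∸ k) ] when ⌊ t ∷ ts ≡ˡ? k ∷ ys ⌋ 1 ≡ when ⌊ k ≟ t ⌋ (rest k)
    firstEntry k = trans (∑-cong (incLists f k (suc n ∸ k)) λ ys → trans (cong (λ b → when b 1) (∷≡ˡ?∷ t ts k ys)) (when-∧ ⌊ k ≟ t ⌋ _ 1))
                         (sym (when-∑ ⌊ k ≟ t ⌋ (incLists f k (suc n ∸ k)) _))
    atFirstEntry : Dec (t < suc (suc n)) → ∑[ k ← upTo (suc (suc n)) ] when ⌊ k ≟ t ⌋ (when (allowed k) (rest k)) ≡ when ⌊ t + sum ts ≟ suc n ⌋ 1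
    atFirstEntry (yes t<) = begin
      _ ≡⟨ ∑-δ ℕ._≟_ (λ k → when (allowed k) (rest k)) (Unique.upTo⁺ (suc (suc n))) (∈-upTo⁺ t<) ⟩
      when (allowed t) (rest t)
        ≡⟨ cong₂ (λ a b → when (a ∧ b) (rest t)) (⌊⌋-yes (lo ≤? t) lo≤t) (⌊⌋-yes (1 ≤? t) 1≤t) ⟩
      rest t
        ≡⟨ ∑-incLists f t (suc n ∸ t) ts (ℕP.≤-trans (ℕP.∸-monoʳ-≤ (suc n) 1≤t) n≤f) incTs ⟩
      when ⌊ sum ts ≟ suc n ∸ t ⌋ 1
        ≡⟨ cong (λ b → when b 1) (⌊⌋-⇔ (mk⇔ (λ eq → trans (cong (t +_) eq) (ℕP.m+[n∸m]≡n (ℕP.≤-pred t<)))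
                                              (λ eq → trans (sym (ℕP.m+n∸m≡n t (sum ts))) (cong (_∸ t) eq)))
                                         (sum ts ≟ suc n ∸ t) (t + sum ts ≟ suc n)) ⟩
      when ⌊ t + sum ts ≟ suc n ⌋ 1 ∎
    atFirstEntry (no t≮) = trans (∑-δ-∉ ℕ._≟_ _ (t≮ ∘ ∈-upTo⁻))
      (sym (cong (λ b → when b 1) (⌊⌋-no (t + sum ts ≟ suc n)
        (λ eq → t≮ (s≤s (ℕP.≤-trans (ℕP.m≤m+n t (sum ts)) (ℕP.≤-reflexive eq)))))))

  ∑-partitionsOf : ∀ t k → ∑[ μ ← partitionsOf k ] when ⌊ t ≟ₚ μ ⌋ 1 ≡ when ⌊ size t ≟ k ⌋ 1
  ∑-partitionsOf t k = begin
    ∑[ μ ← partitionsOf k ] when ⌊ t ≟ₚ μ ⌋ 1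
      ≡⟨ ∑-map (incLists k 1 k) toPartition _ ⟩
    ∑[ xs ← incLists k 1 k ] when ⌊ t ≟ₚ toPartition xs ⌋ 1
      ≡⟨ ∑-congᴬ (incLists-increasing k 1 k) (λ xs (sorted , pos , _) →
           cong (λ ys → when ⌊ parts t ≡ˡ? ys ⌋ 1) (parts-toPartition sorted pos)) ⟩
    ∑[ xs ← incLists k 1 k ] when ⌊ parts t ≡ˡ? xs ⌋ 1
      ≡⟨ ∑-incLists k 1 k (parts t) ℕP.≤-refl (parts-sorted t , parts-pos t , parts-pos t) ⟩
    when ⌊ size t ≟ k ⌋ 1 ∎
    where open ≡-Reasoning

  ∑-partitionsOf-when : ∀ t k (g : Partition → ℕ) → ∑[ μ ← partitionsOf k ] when ⌊ t ≟ₚ μ ⌋ (g μ) ≡ when ⌊ size t ≟ k ⌋ (g t)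
  ∑-partitionsOf-when t k g = begin
    ∑[ μ ← partitionsOf k ] when ⌊ t ≟ₚ μ ⌋ (g μ)          ≡⟨ ∑-cong (partitionsOf k) (λ μ → trans (atT μ (t ≟ₚ μ)) (when-*ʳ ⌊ t ≟ₚ μ ⌋ (g t))) ⟩
    ∑[ μ ← partitionsOf k ] (when ⌊ t ≟ₚ μ ⌋ 1 * g t)      ≡⟨ *-distribʳ-∑ (partitionsOf k) (g t) _ ⟨
    (∑[ μ ← partitionsOf k ] when ⌊ t ≟ₚ μ ⌋ 1) * g t      ≡⟨ cong (_* g t) (∑-partitionsOf t k) ⟩
    when ⌊ size t ≟ k ⌋ 1 * g t                            ≡⟨ when-*ʳ ⌊ size t ≟ k ⌋ (g t) ⟨
    when ⌊ size t ≟ k ⌋ (g t)                              ∎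
    where
    open ≡-Reasoning
    atT : ∀ μ (d : Dec (parts t ≡ parts μ)) → when ⌊ d ⌋ (g μ) ≡ when ⌊ d ⌋ (g t)
    atT μ (yes t≡μ) = cong g (parts-injective (sym t≡μ))
    atT μ (no _)    = refl

module Coproducts where
  open Sums
  open Multisets
  open SplitCounts
  open import Data.Bool using (true; false; _∧_; if_then_else_)
  open import Data.List using (List; []; _∷_; _++_; concatMap; upTo)
  open import Data.List.Membership.Propositional using (_∈_)
  open import Data.List.Membership.Propositional.Properties using (∈-upTo⁺)
  open import Data.List.Relation.Binary.Permutation.Propositional using (_↭_; ↭-sym; ↭-trans)
  import Data.List.Relation.Binary.Permutation.Propositional.Properties as ↭
  open import Data.List.Relation.Unary.All as All using (All; []; _∷_)
  import Data.List.Relation.Unary.All.Properties as All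
  open import Data.List.Relation.Unary.Unique.Propositional using (Unique; []; _∷_)
  import Data.List.Relation.Unary.Unique.Propositional.Properties as Unique
  open import Data.Nat as ℕ using (ℕ; suc; _+_; _*_; _∸_; _≤_; _≟_; _⊔_; s≤s)
  open import Data.Nat.ListAction using (sum)
  import Data.Nat.Properties as ℕP
  open import Data.Product using (_×_; _,_; proj₁; proj₂; uncurry)
  open import Data.Product.Properties using (,-injective)
  open import Function using (_⇔_)
  open import Relation.Binary.Definitions using (DecidableEquality)
  open import Relation.Binary.PropositionalEquality
    using (_≡_; _≢_; _≗_; refl; cong; cong₂; sym; trans; subst; module ≡-Reasoning)
  open import Relation.Nullary using (yes; no)
  open import Relation.Nullary.Decidable using (⌊_⌋; map′; _×-dec_)
  open Sum ℕP.+-*-commutativeSemiring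

  _≟ᴾ_ : DecidableEquality Partition
  μ ≟ᴾ ν = map′ parts-injective (cong parts) (μ ≟ₚ ν)

  _≟ᴾ²_ : DecidableEquality (Partition × Partition)
  (μ₁ , ν₁) ≟ᴾ² (μ₂ , ν₂) = map′ (uncurry (cong₂ _,_)) ,-injective (μ₁ ≟ᴾ μ₂ ×-dec ν₁ ≟ᴾ ν₂)

  ⌊≟ᴾ²⌋ : ∀ μ₁ ν₁ μ₂ ν₂ → ⌊ (μ₁ , ν₁) ≟ᴾ² (μ₂ , ν₂) ⌋ ≡ ⌊ μ₁ ≟ₚ μ₂ ⌋ ∧ ⌊ ν₁ ≟ₚ ν₂ ⌋
  ⌊≟ᴾ²⌋ μ₁ ν₁ μ₂ ν₂ with μ₁ ≟ₚ μ₂ | ν₁ ≟ₚ ν₂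
  ... | yes _ | yes _ = refl
  ... | yes _ | no  _ = refl
  ... | no  _ | yes _ = refl
  ... | no  _ | no  _ = refl

  module Coproduct {c ℓ} (K : Field c ℓ) where
    open SymFun K using (Δpairs)

    private
      pairsWithSum : Partition → ℕ → Partition → Partition → List (Partition × Partition)
      pairsWithSum λ' k μ ν = if ⌊ (μ ⊔ₚ ν) ≟ₚ λ' ⌋ then (μ , ν) ∷ [] else []

      pairsWithFirst : Partition → ℕ → Partition → List (Partition × Partition)
      pairsWithFirst λ' k μ = concatMap (pairsWithSum λ' k μ) (partitionsOf (size λ' ∸ k))

      pairsOfSize : Partition → ℕ → List (Partition × Partition)
      pairsOfSize λ' k = concatMap (pairsWithFirst λ' k) (partitionsOf k)

    ∑-Δpairs : ∀ λ' (h : Partition × Partition → ℕ) → ∑ (Δpairs λ') h ≡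
      ∑[ k ← upTo (suc (size λ')) ] ∑[ μ ← partitionsOf k ] ∑[ ν ← partitionsOf (size λ' ∸ k) ] when ⌊ (μ ⊔ₚ ν) ≟ₚ λ' ⌋ (h (μ , ν) + 0)
    ∑-Δpairs λ' h = trans (∑-concatMap (upTo (suc (size λ'))) (pairsOfSize λ') h) (∑-cong (upTo (suc (size λ'))) λ k →
      trans (∑-concatMap (partitionsOf k) (pairsWithFirst λ' k) h) (∑-cong (partitionsOf k) λ μ →
        trans (∑-concatMap (partitionsOf (size λ' ∸ k)) (pairsWithSum λ' k μ) h) (∑-cong (partitionsOf (size λ' ∸ k)) λ ν →
          ∑-if-[] ⌊ (μ ⊔ₚ ν) ≟ₚ λ' ⌋ ((μ , ν) ∷ []) h)))

    Δpairs-⊔ : ∀ λ' → All (λ p → parts (proj₁ p ⊔ₚ proj₂ p) ≡ parts λ') (Δpairs λ')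
    Δpairs-⊔ λ' = concatMap⁺ (upTo (suc (size λ'))) λ k → concatMap⁺ (partitionsOf k) λ μ →
      concatMap⁺ (partitionsOf (size λ' ∸ k)) λ ν → single μ ν
      where
      concatMap⁺ : ∀ {A B : Set} {P : B → Set} {g : A → List B} xs → (∀ x → All P (g x)) → All P (concatMap g xs)
      concatMap⁺ []       h = []
      concatMap⁺ (x ∷ xs) h = All.++⁺ (h x) (concatMap⁺ xs h)
      single : ∀ μ ν → All (λ p → parts (proj₁ p ⊔ₚ proj₂ p) ≡ parts λ') (if ⌊ (μ ⊔ₚ ν) ≟ₚ λ' ⌋ then (μ , ν) ∷ [] else [])
      single μ ν with (μ ⊔ₚ ν) ≟ₚ λ'
      ... | yes eq = eq ∷ []
      ... | no  _  = []

    Δpairs-once : ∀ λ' t₁ t₂ → parts (t₁ ⊔ₚ t₂) ≡ parts λ' → ∑[ p ← Δpairs λ' ] when ⌊ (t₁ , t₂) ≟ᴾ² p ⌋ 1 ≡ 1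
    Δpairs-once λ' t₁ t₂ t₁⊔t₂≡λ = begin
      ∑[ p ← Δpairs λ' ] when ⌊ (t₁ , t₂) ≟ᴾ² p ⌋ 1
        ≡⟨ ∑-Δpairs λ' _ ⟩
      ∑[ k ← upTo (suc S) ] ∑[ μ ← partitionsOf k ] ∑[ ν ← partitionsOf (S ∸ k) ]
        when ⌊ (μ ⊔ₚ ν) ≟ₚ λ' ⌋ (when ⌊ (t₁ , t₂) ≟ᴾ² (μ , ν) ⌋ 1 + 0)
        ≡⟨ ∑-cong (upTo (suc S)) (λ k → ∑-cong (partitionsOf k) λ μ → trans
             (∑-cong (partitionsOf (S ∸ k)) λ ν → reorder μ ν)
             (sym (when-∑ ⌊ t₁ ≟ₚ μ ⌋ (partitionsOf (S ∸ k)) λ ν → when ⌊ t₂ ≟ₚ ν ⌋ (joins μ ν)))) ⟩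
      ∑[ k ← upTo (suc S) ] ∑[ μ ← partitionsOf k ] when ⌊ t₁ ≟ₚ μ ⌋ (∑[ ν ← partitionsOf (S ∸ k) ] when ⌊ t₂ ≟ₚ ν ⌋ (joins μ ν))
        ≡⟨ ∑-cong (upTo (suc S)) (λ k → ∑-partitionsOf-when t₁ k λ μ → ∑[ ν ← partitionsOf (S ∸ k) ] when ⌊ t₂ ≟ₚ ν ⌋ (joins μ ν)) ⟩
      ∑[ k ← upTo (suc S) ] when ⌊ size t₁ ≟ k ⌋ (∑[ ν ← partitionsOf (S ∸ k) ] when ⌊ t₂ ≟ₚ ν ⌋ (joins t₁ ν))
        ≡⟨ ∑-cong (upTo (suc S)) (λ k → cong (when ⌊ size t₁ ≟ k ⌋) (∑-partitionsOf-when t₂ (S ∸ k) (joins t₁))) ⟩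
      ∑[ k ← upTo (suc S) ] when ⌊ size t₁ ≟ k ⌋ (when ⌊ size t₂ ≟ S ∸ k ⌋ (joins t₁ t₂))
        ≡⟨ ∑-δ′ ℕ._≟_ (λ k → when ⌊ size t₂ ≟ S ∸ k ⌋ (joins t₁ t₂)) (Unique.upTo⁺ (suc S)) (∈-upTo⁺ (s≤s size₁≤S)) ⟩
      when ⌊ size t₂ ≟ S ∸ size t₁ ⌋ (joins t₁ t₂)
        ≡⟨ cong₂ (λ a b → when a (when b 1)) (⌊⌋-yes (size t₂ ≟ S ∸ size t₁) size₂≡) (⌊⌋-yes ((t₁ ⊔ₚ t₂) ≟ₚ λ') t₁⊔t₂≡λ) ⟩
      1 ∎
      where
      open ≡-Reasoning
      S = size λ'
      joins : Partition → Partition → ℕ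
      joins μ ν = when ⌊ (μ ⊔ₚ ν) ≟ₚ λ' ⌋ 1
      sizes : size t₁ + size t₂ ≡ S
      sizes = trans (sym (size-⊔ t₁ t₂)) (cong sum t₁⊔t₂≡λ)
      size₁≤S : size t₁ ≤ S
      size₁≤S = ℕP.≤-trans (ℕP.m≤m+n (size t₁) (size t₂)) (ℕP.≤-reflexive sizes)
      size₂≡ : size t₂ ≡ S ∸ size t₁
      size₂≡ = sym (trans (cong (_∸ size t₁) (sym sizes)) (ℕP.m+n∸m≡n (size t₁) (size t₂)))
      reorder : ∀ μ ν → when ⌊ (μ ⊔ₚ ν) ≟ₚ λ' ⌋ (when ⌊ (t₁ , t₂) ≟ᴾ² (μ , ν) ⌋ 1 + 0) ≡
                        when ⌊ t₁ ≟ₚ μ ⌋ (when ⌊ t₂ ≟ₚ ν ⌋ (joins μ ν))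
      reorder μ ν rewrite ⌊≟ᴾ²⌋ t₁ t₂ μ ν | ℕP.+-identityʳ (when (⌊ t₁ ≟ₚ μ ⌋ ∧ ⌊ t₂ ≟ₚ ν ⌋) 1)
        with ⌊ (μ ⊔ₚ ν) ≟ₚ λ' ⌋ | ⌊ t₁ ≟ₚ μ ⌋ | ⌊ t₂ ≟ₚ ν ⌋
      ... | a | true  | true  = refl
      ... | a | true  | false = when-zero a
      ... | a | false | _     = when-zero a

  splits-pos : ∀ {xs} → All (1 ≤_) xs → All (λ s → All (1 ≤_) (proj₁ s) × All (1 ≤_) (proj₂ s)) (splits xs)
  splits-pos {xs} pos = All.map (λ {s} s↭xs → All.++⁻ (proj₁ s) (All-resp-↭ (↭-sym s↭xs) pos)) (splits-↭ xs)
    where open import Data.List.Relation.Binary.Permutation.Propositional.Properties using (All-resp-↭)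

  ∑-splits-count : ∀ xs {us vs} → xs ↭ us ++ vs →
    (∑[ s ← splits xs ] when (⌊ proj₁ s ↭? us ⌋ ∧ ⌊ proj₂ s ↭? vs ⌋) 1) * (listFactor us * listFactor vs) ≡ listFactor xs
  ∑-splits-count xs {us} {vs} xs↭ = trans (*-distribʳ-∑ (splits xs) _ _)
    (trans (∑-cong (splits xs) λ s → byCases ⌊ proj₁ s ↭? us ⌋ ⌊ proj₂ s ↭? vs ⌋) (∑-splits-matchings xs xs↭))
    where
    byCases : ∀ a b → when (a ∧ b) 1 * (listFactor us * listFactor vs) ≡ when a (listFactor us) * when b (listFactor vs)
    byCases true  true  = ℕP.+-identityʳ _
    byCases true  false = sym (ℕP.*-zeroʳ (listFactor us))
    byCases false _     = refl

  module SplitImages (λ' : Partition) where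

    split-image : List ℕ × List ℕ → Partition × Partition
    split-image s = toPartition (proj₁ s) , toPartition (proj₂ s)

    split-image-⊔ : All (λ s → parts (proj₁ (split-image s) ⊔ₚ proj₂ (split-image s)) ≡ parts λ') (splits (parts λ'))
    split-image-⊔ = All.zipWith (λ {s} (s↭ , pos) → image-⊔ s s↭ pos) (splits-↭ (parts λ') , splits-pos (parts-pos λ'))
      where
      image-⊔ : ∀ s → proj₁ s ++ proj₂ s ↭ parts λ' → All (1 ≤_) (proj₁ s) × All (1 ≤_) (proj₂ s) →
                parts (toPartition (proj₁ s) ⊔ₚ toPartition (proj₂ s)) ≡ parts λ'
      image-⊔ (s₁ , s₂) s↭ (pos₁ , pos₂) = sorted-↭⇒≡ (parts-sorted (toPartition s₁ ⊔ₚ toPartition s₂)) (parts-sorted λ')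
        (↭-trans (parts-⊔ (toPartition s₁) (toPartition s₂)) (↭-trans (↭.++⁺ (parts-toPartition-↭ pos₁) (parts-toPartition-↭ pos₂)) s↭))

    ⌊split-image≟⌋ : ∀ s → All (1 ≤_) (proj₁ s) × All (1 ≤_) (proj₂ s) → ∀ p →
                     ⌊ split-image s ≟ᴾ² p ⌋ ≡ ⌊ proj₁ s ↭? parts (proj₁ p) ⌋ ∧ ⌊ proj₂ s ↭? parts (proj₂ p) ⌋
    ⌊split-image≟⌋ s (pos₁ , pos₂) p = trans (⌊≟ᴾ²⌋ _ _ (proj₁ p) (proj₂ p)) (cong₂ _∧_
      (⌊⌋-⇔ (parts-toPartition≡⇔↭ pos₁ (proj₁ p)) (toPartition (proj₁ s) ≟ₚ proj₁ p) (proj₁ s ↭? parts (proj₁ p)))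
      (⌊⌋-⇔ (parts-toPartition≡⇔↭ pos₂ (proj₂ p)) (toPartition (proj₂ s) ≟ₚ proj₂ p) (proj₂ s ↭? parts (proj₂ p))))

    fibre-count : ∀ p → parts (proj₁ p ⊔ₚ proj₂ p) ≡ parts λ' →
      (∑[ s ← splits (parts λ') ] when ⌊ split-image s ≟ᴾ² p ⌋ 1) * (listFactor (parts (proj₁ p)) * listFactor (parts (proj₂ p)))
        ≡ listFactor (parts λ')
    fibre-count p ⊔≡λ = trans
      (cong (_* _) (∑-congᴬ (splits-pos (parts-pos λ')) λ s pos → cong (λ b → when b 1) (⌊split-image≟⌋ s pos p)))
      (∑-splits-count (parts λ') (subst (_↭ parts (proj₁ p) ++ parts (proj₂ p)) ⊔≡λ (parts-⊔ (proj₁ p) (proj₂ p))))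

module Convolution where
  open Sums
  open Multisets
  open Characters
  open ChromaticCoefficients
  open Coproducts
  open import Data.Bool using (Bool; true; false)
  open import Data.List using (List; map)
  open import Data.List.Relation.Unary.All as All using (All)
  open import Data.Nat as ℕ using (ℕ)
  import Data.Nat.Properties as ℕP
  open import Data.Product using (_×_; _,_; proj₁; proj₂)
  open import Function using (_∘_)
  import Relation.Binary.PropositionalEquality as ≡
  open import Relation.Nullary.Decidable using (⌊_⌋)
  open ≡ using (_≡_)

  module ConvolutionOfCharacters {c ℓ} (K : Field c ℓ) where
    open Field K
    open FieldOps K
    open SymFun K
    open CharacterTheory K
    open Coproduct K
    module ℕ∑ = Sum ℕP.+-*-commutativeSemiring
    open import Relation.Binary.Reasoning.Setoid setoid
    open import Algebra.Properties.CommutativeSemigroup *-commutativeSemigroup using (interchange)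

    fromℕ-when₁ : ∀ b → fromℕ (ℕ∑.when b 1) ≈ when b 1#
    fromℕ-when₁ true  = +-identityʳ 1#
    fromℕ-when₁ false = refl

    fromℕ-count : ∀ {A : Set} (xs : List A) (P : A → Bool) → fromℕ (ℕ∑.∑[ x ← xs ] ℕ∑.when (P x) 1) ≈ ∑[ x ← xs ] when (P x) 1#
    fromℕ-count xs P = trans (fromℕ-sum xs _) (∑-cong xs λ x → fromℕ-when₁ (P x))

    module _ (ζ ξ : Character) (λ' : Partition) where
      open SplitImages λ'

      a b : ℕ → Carrier
      a = sequenceOf (proj₁ ζ)
      b = sequenceOf (proj₁ ξ)

      xs : List ℕ
      xs = parts λ'

      G : Partition × Partition → Carrier
      G p = ev (proj₁ ζ) (m̃ (proj₁ p)) * ev (proj₁ ξ) (m̃ (proj₂ p))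

      fibre : ∀ p → parts (proj₁ p ⊔ₚ proj₂ p) ≡ parts λ' →
              fromℕ (listFactor xs) * (proj₁ ζ (proj₁ p) * proj₁ ξ (proj₂ p)) ≈
              ∑[ s ← splits xs ] when ⌊ split-image s ≟ᴾ² p ⌋ (G (split-image s))
      fibre p ⊔≡λ = begin
        fromℕ (listFactor xs) * (ζ₁ * ξ₂)
          ≈⟨ *-congʳ (≡⇒≈ (≡.cong fromℕ (fibre-count p ⊔≡λ))) ⟨
        fromℕ (N ℕ.* (listFactor (parts μ) ℕ.* listFactor (parts ν))) * (ζ₁ * ξ₂)
          ≈⟨ *-congʳ (trans (fromℕ-* N _) (*-congˡ (fromℕ-* (listFactor (parts μ)) _))) ⟩
        fromℕ N * (fromℕ (listFactor (parts μ)) * fromℕ (listFactor (parts ν))) * (ζ₁ * ξ₂)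
          ≈⟨ *-assoc _ _ _ ⟩
        fromℕ N * (fromℕ (listFactor (parts μ)) * fromℕ (listFactor (parts ν)) * (ζ₁ * ξ₂))
          ≈⟨ *-congˡ (trans (interchange (fromℕ (listFactor (parts μ))) (fromℕ (listFactor (parts ν))) ζ₁ ξ₂)
                            (sym (*-cong (ev-m̃ (proj₁ ζ) μ) (ev-m̃ (proj₁ ξ) ν)))) ⟩
        fromℕ N * G p
          ≈⟨ *-congʳ (fromℕ-count (splits xs) λ s → ⌊ split-image s ≟ᴾ² p ⌋) ⟩
        (∑[ s ← splits xs ] when ⌊ split-image s ≟ᴾ² p ⌋ 1#) * G p
          ≈⟨ trans (*-distribʳ-∑ (splits xs) (G p) _) (∑-cong (splits xs) λ s → sym (when-*ʳ _ (G p))) ⟩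
        ∑[ s ← splits xs ] when ⌊ split-image s ≟ᴾ² p ⌋ (G p)
          ≈⟨ ∑-cong (splits xs) (λ s → sym (when-≟ _≟ᴾ²_ G)) ⟩
        ∑[ s ← splits xs ] when ⌊ split-image s ≟ᴾ² p ⌋ (G (split-image s)) ∎
        where
        μ = proj₁ p
        ν = proj₂ p
        ζ₁ = proj₁ ζ μ
        ξ₂ = proj₁ ξ ν
        N = ℕ∑.∑[ s ← splits xs ] ℕ∑.when ⌊ split-image s ≟ᴾ² p ⌋ 1

      once : All (λ s → ∑[ p ← Δpairs λ' ] when ⌊ split-image s ≟ᴾ² p ⌋ 1# ≈ 1#) (splits xs)
      once = All.map (λ {s} ⊔≡λ → trans (sym (fromℕ-count (Δpairs λ') λ p → ⌊ split-image s ≟ᴾ² p ⌋))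
                                         (trans (≡⇒≈ (≡.cong fromℕ (Δpairs-once λ' _ _ ⊔≡λ))) (+-identityʳ 1#)))
                     split-image-⊔

      convolution-productFormula : ev (proj₁ ζ ⋆ proj₁ ξ) (m̃ λ') ≈ Πᴷ (map (λ n → a n + b n) xs)
      convolution-productFormula = begin
        ev (proj₁ ζ ⋆ proj₁ ξ) (m̃ λ')
          ≈⟨ ev-m̃ (proj₁ ζ ⋆ proj₁ ξ) λ' ⟩
        fromℕ (listFactor xs) * ∑[ p ← Δpairs λ' ] (proj₁ ζ (proj₁ p) * proj₁ ξ (proj₂ p))
          ≈⟨ *-distribˡ-∑ (Δpairs λ') _ _ ⟩
        ∑[ p ← Δpairs λ' ] (fromℕ (listFactor xs) * (proj₁ ζ (proj₁ p) * proj₁ ξ (proj₂ p)))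
          ≈⟨ ∑-congᴬ (Δpairs-⊔ λ') fibre ⟩
        ∑[ p ← Δpairs λ' ] ∑[ s ← splits xs ] when ⌊ split-image s ≟ᴾ² p ⌋ (G (split-image s))
          ≈⟨ ∑-fibres _≟ᴾ²_ split-image (Δpairs λ') once (G ∘ split-image) ⟨
        ∑[ s ← splits xs ] G (split-image s)
          ≈⟨ ∑-congᴬ (splits-pos (parts-pos λ')) (λ s (pos₁ , pos₂) →
               *-cong (character-productFormula-toPartition ζ pos₁) (character-productFormula-toPartition ξ pos₂)) ⟩
        ∑[ s ← splits xs ] (∏ (proj₁ s) a * ∏ (proj₂ s) b)
          ≈⟨ ∏-+ a b xs ⟨
        Πᴷ (map (λ n → a n + b n) xs) ∎

open Characters
open ChromaticCharacters
open Convolution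

proposition1p3 :
    ∀ {c ℓ} (K : Field c ℓ) → CharZero K →
    let open Field K
        open FieldOps K
        open SymFun K
    in
    -- (i) a character is uniquely determined by a_n = ζ(m̃_n), n ≥ 1
    (∀ (ζ ξ : Character) →
       (∀ n → 1 ≤ n → ev (proj₁ ζ) (m̃ [ n ]ₚ) ≈ ev (proj₁ ξ) (m̃ [ n ]ₚ)) →
       ∀ λ' → proj₁ ζ λ' ≈ proj₁ ξ λ')
    ×
    -- (ii) every sequence (a_n)_{n ≥ 1} arises from a character ζ_a
    (∀ (a : ℕ → Carrier) →
       Σ Character (λ ζ → ∀ n → 1 ≤ n → ev (proj₁ ζ) (m̃ [ n ]ₚ) ≈ a n))
    ×
    -- (iii) ζ_a(X_G) = Σ_λ |St_λ(G)| a_{λ_1} ⋯ a_{λ_ℓ}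
    (∀ (ζ : Character) (G : WGraph) →
       ev (proj₁ ζ) (X G) ≈
         Σᴷ (map (λ λ' → fromℕ (numSt G λ') *
                          Πᴷ (map (λ p → ev (proj₁ ζ) (m̃ [ p ]ₚ)) (parts λ')))
                 (partitionsOf (totalWeight G))))
    ×
    -- (iv) ζ_a * ζ_b is a character, with sequence a_n + b_n
    (∀ (ζ ξ : Character) →
       Σ (IsCharacter (proj₁ ζ ⋆ proj₁ ξ)) (λ _ →
         ∀ n → 1 ≤ n →
           ev (proj₁ ζ ⋆ proj₁ ξ) (m̃ [ n ]ₚ) ≈
             ev (proj₁ ζ) (m̃ [ n ]ₚ) + ev (proj₁ ξ) (m̃ [ n ]ₚ)))
proposition1p3 K char0 =
  characters-unique , character-exists , chromatic-productFormula K , λ ζ ξ →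
    productFormula⇒isCharacter (convolution-productFormula ζ ξ) , productFormula⇒sequence (convolution-productFormula ζ ξ)
  where
  open CharacterTheory K
  open CharZeroCharacters K char0
  open ConvolutionOfCharacters K
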